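{- For terms $M,M',N$ of the resource calculus: if $M\to_{\neg lm}M'\to_{lm}N$, then there is a term $M''$ such that $M\to_{lm}M''\to_{o}N$.
   Context: Resource calculus. Terms: $M ::= x \mid \lambda x.M \mid MP$; resources: $M$ (linear) or $M^{!}$ (reusable); bags are finite multisets of resources, written multiplicatively: $1$ empty, $[N]\cdot P$, $[N^{!}]\cdot P$. Sums are finite formal sums, $0$ the empty sum; constructors extend linearly to sums except $[(\sum_{i=1}^kM_i)^{!}]\cdot P=[M_1^{!},\dots,M_k^{!}]\cdot P$. $A\{N/x\}$ is capture-free substitution. Linear substitution: $x\langle N/x\rangle=N$, $y\langle N/x\rangle=0$ ($y\ne x$), $(\lambda y.M)\langle N/x\rangle=\lambda y.M\langle N/x\rangle$, $(MP)\langle N/x\rangle=M\langle N/x\rangle P+MP\langle N/x\rangle$, $1\langle N/x\rangle=0$, $([M]\cdot P)\langle N/x\rangle=[M\langle N/x\rangle]\cdot P+[M]\cdot P\langle N/x\rangle$, $([M^{!}]\cdot P)\langle N/x\rangle=[M\langle N/x\rangle,M^{!}]\cdot P+[M^{!}]\cdot P\langle N/x\rangle$, extended bilinearly. $A\langle N^{!}/x\rangle:=A\{N+x/x\}$; bag substitution $A\langle[N_1^{(!)},\dots,N_n^{(!)}]/x\rangle:=A\langle N_1^{(!)}/x\rangle\cdots\langle N_n^{(!)}/x\rangle$. Giant step: $(\lambda x.M)P\to_g M\langle P/x\rangle\{0/x\}$ closed under one-hole contexts; non-deterministic step $M\to_{nd}N$ iff $M\to_gN+\mathbb A$ for some sum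 $\mathbb A$. Outer step $\to_o$: a non-deterministic step firing a redex not under the scope of any $(\cdot)^{!}$. Leftmost redexes: $\mathcal L(x)=\emptyset$, $\mathcal L(\lambda x.M)=\mathcal L(M)$, $\mathcal L(MP)=\{MP\}$ if $M$ is an abstraction, otherwise $\mathcal L(M)$ if $\mathcal L(M)\ne\emptyset$, otherwise $\mathcal L(P)$; $\mathcal L(1)=\emptyset$, $\mathcal L([M^{!}]\cdot P)=\mathcal L(P)$, $\mathcal L([M]\cdot P)=\mathcal L(M)\cup\mathcal L(P)$. $M\to_{lm}N$ denotes an outer non-deterministic step firing a redex in $\mathcal L(M)$; $M\to_{\neg lm}N$ denotes an outer non-deterministic step firing a redex not in $\mathcal L(M)$. -}

module Defs where

-- Resource calculus, with terms in de Bruijn notation (so alpha-equivalence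
-- is syntactic equality).  Bags are lists of resources, finite formal sums
-- are lists of terms (resp. bags); both are identified up to permutation by
-- the equivalence _≈_ below (bags) and by membership up to _≈_ (sums).

open import Data.Nat using (ℕ; zero; suc; _≡ᵇ_)
open import Data.Bool using (if_then_else_)
open import Data.List using (List; []; _∷_; [_]; map; _++_; concatMap)
open import Data.List.Relation.Unary.Any using (Any)
open import Data.Product using (Σ; _×_)
open import Data.Unit using (⊤)
open import Data.Empty using (⊥)
open import Relation.Nullary using (¬_)

mutual
  data Term : Set where
    var : ℕ → Term
    lam : Term → Term
    app : Term → Bag → Term

  data Res : Set where
    lin  : Term → Res
    bang : Term → Res

  Bag : Set
  Bag = List Res

-- finite formal sums of terms (0 = [], + = _++_), up to permutation
TSum : Set
TSum = List Term

BSum : Set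
BSum = List Bag

mutual
  data _≈_ : Term → Term → Set where
    var : ∀ {n} → var n ≈ var n
    lam : ∀ {M M'} → M ≈ M' → lam M ≈ lam M'
    app : ∀ {M M' P P'} → M ≈ M' → P ≈ᵇ P' → app M P ≈ app M' P'

  data _≈ʳ_ : Res → Res → Set where
    lin  : ∀ {M M'} → M ≈ M' → lin M ≈ʳ lin M'
    bang : ∀ {M M'} → M ≈ M' → bang M ≈ʳ bang M'

  data _≈ᵇ_ : Bag → Bag → Set where
    nil   : [] ≈ᵇ []
    prep  : ∀ {r r' b b'} → r ≈ʳ r' → b ≈ᵇ b' → (r ∷ b) ≈ᵇ (r' ∷ b')
    swap  : ∀ {r s b} → (r ∷ s ∷ b) ≈ᵇ (s ∷ r ∷ b)
    trans : ∀ {b c d} → b ≈ᵇ c → c ≈ᵇ d → b ≈ᵇ d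

_∈Σ_ : Term → TSum → Set
N ∈Σ S = Any (N ≈_) S

Ren : Set
Ren = ℕ → ℕ

ext : Ren → Ren
ext ρ zero    = zero
ext ρ (suc n) = suc (ρ n)

mutual
  rename : Ren → Term → Term
  rename ρ (var n)   = var (ρ n)
  rename ρ (lam M)   = lam (rename (ext ρ) M)
  rename ρ (app M P) = app (rename ρ M) (renameB ρ P)

  renameB : Ren → Bag → Bag
  renameB ρ []           = []
  renameB ρ (lin M ∷ b)  = lin (rename ρ M) ∷ renameB ρ b
  renameB ρ (bang M ∷ b) = bang (rename ρ M) ∷ renameB ρ b

shift : Term → Term
shift = rename suc

-- Capture-free (parallel) substitution of sums for variables: A{S/x}.
-- Constructors are extended (multi)linearly to sums, except
-- [(Σ Mi)^!]·P = [M1^!,…,Mk^!]·P.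

SSub : Set
SSub = ℕ → TSum

exts : SSub → SSub
exts σ zero    = [ var zero ]
exts σ (suc n) = map shift (σ n)

mutual
  subst : SSub → Term → TSum
  subst σ (var n)   = σ n
  subst σ (lam M)   = map lam (subst (exts σ) M)
  subst σ (app M P) =
    concatMap (λ M' → map (app M') (substB σ P)) (subst σ M)

  substB : SSub → Bag → BSum
  substB σ []           = [ [] ]
  substB σ (lin M ∷ b)  =
    concatMap (λ M' → map (lin M' ∷_) (substB σ b)) (subst σ M)
  substB σ (bang M ∷ b) = map (map bang (subst σ M) ++_) (substB σ b)

-- Linear substitution M⟨N/x⟩ (N lives in the same context as M)

mutual
  lsub : ℕ → Term → Term → TSum
  lsub x N (var y)   = if y ≡ᵇ x then [ N ] else []
  lsub x N (lam M)   = map lam (lsub (suc x) (shift N) M)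
  lsub x N (app M P) =
    map (λ M' → app M' P) (lsub x N M) ++ map (app M) (lsubB x N P)

  lsubB : ℕ → Term → Bag → BSum
  lsubB x N []           = []
  lsubB x N (lin M ∷ b)  =
    map (λ M' → lin M' ∷ b) (lsub x N M) ++ map (lin M ∷_) (lsubB x N b)
  lsubB x N (bang M ∷ b) =
    map (λ M' → lin M' ∷ bang M ∷ b) (lsub x N M) ++ map (bang M ∷_) (lsubB x N b)

-- A⟨N^!/x⟩ := A{N + x / x}
bsub : ℕ → Term → Term → TSum
bsub x N A = subst σ A
  where
  σ : SSub
  σ y = if y ≡ᵇ x then N ∷ var y ∷ [] else [ var y ]

-- Bag substitution M⟨P/0⟩ for the body M of λ.M, where the terms of P live
-- outside the binder (hence are shifted):  A⟨[N1,…,Nn]/x⟩ = A⟨N1/x⟩⋯⟨Nn/x⟩,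
-- extended linearly to sums.
bagSub : Bag → Term → TSum
bagSub []           A = [ A ]
bagSub (lin N ∷ b)  A = concatMap (bagSub b) (lsub zero (shift N) A)
bagSub (bang N ∷ b) A = concatMap (bagSub b) (bsub zero (shift N) A)

-- {0/x} for the bound variable 0, removing the binder (indices lowered)
zeroSub : SSub
zeroSub zero    = []
zeroSub (suc n) = [ var n ]

-- Giant step on a redex (λx.M)P  ↦  M⟨P/x⟩{0/x}
giant : Term → Bag → TSum
giant M P = concatMap (subst zeroSub) (bagSub P M)

-- Redex occurrences (one-hole contexts whose hole is a redex)

mutual
  data TPos : Term → Set where
    here  : ∀ {M P} → TPos (app (lam M) P)
    inLam : ∀ {M} → TPos M → TPos (lam M)
    inFun : ∀ {M P} → TPos M → TPos (app M P)
    inArg : ∀ {M P} → BPos P → TPos (app M P)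

  data BPos : Bag → Set where
    inLin  : ∀ {M b} → TPos M → BPos (lin M ∷ b)
    inBang : ∀ {M b} → TPos M → BPos (bang M ∷ b)
    inTail : ∀ {r b} → BPos b → BPos (r ∷ b)

mutual
  fire : (M : Term) → TPos M → TSum
  fire (app (lam M) P) here = giant M P
  fire (lam M)   (inLam p)  = map lam (fire M p)
  fire (app M P) (inFun p)  = map (λ M' → app M' P) (fire M p)
  fire (app M P) (inArg q)  = map (app M) (fireB P q)

  fireB : (b : Bag) → BPos b → BSum
  fireB (lin M ∷ b)  (inLin p)  = map (λ M' → lin M' ∷ b) (fire M p)
  fireB (bang M ∷ b) (inBang p) = [ map bang (fire M p) ++ b ]
  fireB (r ∷ b)      (inTail q) = map (r ∷_) (fireB b q)

mutual
  Outer : ∀ {M} → TPos M → Set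
  Outer here      = ⊤
  Outer (inLam p) = Outer p
  Outer (inFun p) = Outer p
  Outer (inArg q) = OuterB q

  OuterB : ∀ {b} → BPos b → Set
  OuterB (inLin p)  = Outer p
  OuterB (inBang p) = ⊥
  OuterB (inTail q) = OuterB q

IsAbs : Term → Set
IsAbs (var _)   = ⊥
IsAbs (lam _)   = ⊤
IsAbs (app _ _) = ⊥

mutual
  InL : ∀ {M} → TPos M → Set
  InL here      = ⊤
  InL (inLam p) = InL p
  InL {app M P} (inFun p) = ¬ IsAbs M × InL p
  InL {app M P} (inArg q) = ¬ IsAbs M × ¬ Σ (TPos M) (InL {M}) × InLB q

  InLB : ∀ {b} → BPos b → Set
  InLB (inLin p)  = InL p
  InLB (inBang p) = ⊥
  InLB (inTail q) = InLB q

-- Reduction relations.  M →nd N iff M →g N + A: some redex fires to a sum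
-- having N as a summand.

_→o_ : Term → Term → Set
M →o N = Σ (TPos M) λ p → Outer p × N ∈Σ fire M p

_→lm_ : Term → Term → Set
M →lm N = Σ (TPos M) λ p → Outer p × InL p × N ∈Σ fire M p

_→¬lm_ : Term → Term → Set
M →¬lm N = Σ (TPos M) λ p → Outer p × ¬ InL p × N ∈Σ fire M p

-- Let M →¬lm M' fire an outer redex R that is not leftmost, and M' →lm N fire the
-- leftmost redex of M'. The leftmost redex L of M survives the first step, and is the
-- redex fired by the second one. When R and L are disjoint the two steps commute
-- directly. Otherwise L = (λx.A)P is a head redex and R sits, outside any (·)^!, in A or
-- in P; then firing L first and afterwards one outer step on a residual of R reaches N.
-- That last fact is a substitution lemma: linear, reusable and bag substitution reflect
-- outer steps of their body and of their argument. It rests on commutation laws between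
-- these substitutions, all holding only up to reordering of sums and permutation of bags.

module Submission where

open import Defs
open import Data.Bool using (true; false; if_then_else_; T)
open import Data.Empty using (⊥; ⊥-elim)
open import Data.List using (List; []; _∷_; [_]; map; _++_; concatMap)
open import Data.List.Properties
  using (++-identityʳ; ++-assoc; map-++; map-∘; map-cong; map-id;
         concatMap-cong; concatMap-map; map-concatMap; concatMap-++; concatMap-pure)
open import Data.List.Relation.Unary.Any using (here; there)
import Data.List.Relation.Binary.Pointwise as Pointwise
open Pointwise using (Pointwise)
open import Data.List.Membership.Propositional using (_∈_; find; lose)
open import Data.List.Membership.Propositional.Properties
  using (∈-map⁺; ∈-map⁻; ∈-++⁺ˡ; ∈-++⁺ʳ; ∈-++⁻; ∈-concatMap⁺)
import Data.List.Relation.Binary.Permutation.Homogeneous as ↭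
import Data.List.Relation.Binary.Permutation.Setoid as Permutation
import Data.List.Relation.Binary.Permutation.Setoid.Properties as PermutationProperties
open import Data.Nat using (ℕ; zero; suc; _≡ᵇ_)
open import Data.Nat.Properties using (≡ᵇ⇒≡)
open import Data.Product using (Σ; _×_; _,_; proj₁; proj₂)
open import Data.Sum using (_⊎_; inj₁; inj₂)
open import Data.Unit using (tt)
open import Function using (_∘_)
open import Level using (0ℓ)
open import Relation.Binary.Bundles using (Setoid)
open import Relation.Binary.PropositionalEquality
  using (_≡_; refl; sym; cong; cong₂; module ≡-Reasoning) renaming (trans to ≡trans; subst to ≡subst)
open import Relation.Nullary using (¬_; Dec; yes; no)

∈-concatMap⁺′ : ∀ {A B : Set} (f : A → List B) {x y xs} → x ∈ xs → y ∈ f x → y ∈ concatMap f xs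
∈-concatMap⁺′ f x∈xs y∈fx = ∈-concatMap⁺ f (lose x∈xs y∈fx)

-- Proved by recursion rather than as find ∘ ∈-concatMap⁻: with-abstractions normalise the
-- with-expression, and through the stdlib proof that normalisation explodes.
∈-concatMap⁻′ : ∀ {A B : Set} (f : A → List B) xs {y} → y ∈ concatMap f xs → Σ A λ x → x ∈ xs × y ∈ f x
∈-concatMap⁻′ f (x ∷ xs) y∈ with ∈-++⁻ (f x) y∈
... | inj₁ y∈fx = x , here refl , y∈fx
... | inj₂ y∈rest with ∈-concatMap⁻′ f xs y∈rest
...   | z , z∈xs , y∈fz = z , there z∈xs , y∈fz

concatMap-concatMap : ∀ {A B C : Set} (g : B → List C) (f : A → List B) xs →
  concatMap g (concatMap f xs) ≡ concatMap (concatMap g ∘ f) xs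
concatMap-concatMap g f [] = refl
concatMap-concatMap g f (x ∷ xs) =
  ≡trans (concatMap-++ g (f x) _) (cong (concatMap g (f x) ++_) (concatMap-concatMap g f xs))

concatMap-singleton : ∀ {A B : Set} (f : A → B) xs → concatMap (λ x → [ f x ]) xs ≡ map f xs
concatMap-singleton f xs = ≡trans (sym (concatMap-map [_] f xs)) (concatMap-pure (map f xs))

map-∘-comm : ∀ {A B C D : Set} {g : B → D} {f : A → B} {f' : C → D} {g' : A → C} →
  (∀ x → g (f x) ≡ f' (g' x)) → ∀ xs → map g (map f xs) ≡ map f' (map g' xs)
map-∘-comm e xs = ≡trans (sym (map-∘ xs)) (≡trans (map-cong e xs) (map-∘ xs))

module _ (S : Setoid 0ℓ 0ℓ) where
  open Setoid S using () renaming (Carrier to B)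
  open Permutation S using (_↭_; ↭-refl; ↭-trans; ↭-reflexive; module PermutationReasoning)
  open PermutationProperties S using (++⁺; ++⁺ˡ; shifts)

  concatMap-↭-pointwise : ∀ {A : Set} {f g : A → List B} → (∀ x → f x ↭ g x) → ∀ xs → concatMap f xs ↭ concatMap g xs
  concatMap-↭-pointwise t [] = ↭-refl
  concatMap-↭-pointwise t (x ∷ xs) = ++⁺ (t x) (concatMap-↭-pointwise t xs)

  concatMap-++-↭ : ∀ {A : Set} (f g : A → List B) (xs : List A) → concatMap f xs ++ concatMap g xs ↭ concatMap (λ x → f x ++ g x) xs
  concatMap-++-↭ f g [] = ↭-refl
  concatMap-++-↭ f g (x ∷ xs) = begin
    (f x ++ concatMap f xs) ++ g x ++ concatMap g xs   ≡⟨ ++-assoc (f x) _ _ ⟩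
    f x ++ concatMap f xs ++ g x ++ concatMap g xs     ↭⟨ ++⁺ˡ (f x) (shifts (concatMap f xs) (g x)) ⟩
    f x ++ g x ++ concatMap f xs ++ concatMap g xs     ↭⟨ ++⁺ˡ (f x) (++⁺ˡ (g x) (concatMap-++-↭ f g xs)) ⟩
    f x ++ g x ++ concatMap (λ x → f x ++ g x) xs      ≡⟨ ++-assoc (f x) (g x) _ ⟨
    (f x ++ g x) ++ concatMap (λ x → f x ++ g x) xs    ∎
    where open PermutationReasoning

  concatMap-comm : ∀ {A C : Set} (h : A → C → List B) (xs : List A) (ys : List C) →
    concatMap (λ a → concatMap (h a) ys) xs ↭ concatMap (λ c → concatMap (λ a → h a c) xs) ys
  concatMap-comm {C = C} h [] ys = ↭-reflexive (sym (concatMap-[] ys))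
    where
    concatMap-[] : ∀ zs → concatMap (λ (_ : C) → []) zs ≡ []
    concatMap-[] [] = refl
    concatMap-[] (_ ∷ zs) = concatMap-[] zs
  concatMap-comm h (x ∷ xs) ys =
    ↭-trans (++⁺ˡ (concatMap (h x) ys) (concatMap-comm h xs ys)) (concatMap-++-↭ (h x) _ ys)

module _ (SA S : Setoid 0ℓ 0ℓ) where
  open Setoid SA using () renaming (Carrier to A; _≈_ to _≈A_)
  open Setoid S using () renaming (Carrier to B)
  open Permutation SA using () renaming (_↭_ to _↭A_)
  open Permutation S using (_↭_; ↭-refl; ↭-trans)
  open PermutationProperties S using (++⁺; shifts)

  concatMap⁺ : {f : A → List B} → (∀ {x y} → x ≈A y → f x ↭ f y) →
    ∀ {xs ys} → xs ↭A ys → concatMap f xs ↭ concatMap f ys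
  concatMap⁺ t (↭.refl xs≋ys) = pointwise xs≋ys
    where
    pointwise : ∀ {xs ys} → Pointwise _≈A_ xs ys → concatMap _ xs ↭ concatMap _ ys
    pointwise Pointwise.[] = ↭-refl
    pointwise (x≈y Pointwise.∷ xs≋ys) = ++⁺ (t x≈y) (pointwise xs≋ys)
  concatMap⁺ t (↭.prep x≈y p) = ++⁺ (t x≈y) (concatMap⁺ t p)
  concatMap⁺ {f} t (↭.swap {x = x} {y = y} x≈x' y≈y' p) =
    ↭-trans (shifts (f x) (f y)) (++⁺ (t y≈y') (++⁺ (t x≈x') (concatMap⁺ t p)))
  concatMap⁺ t (↭.trans p q) = ↭-trans (concatMap⁺ t p) (concatMap⁺ t q)

mutual
  ≈-refl : ∀ {M} → M ≈ M
  ≈-refl {var n} = var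
  ≈-refl {lam M} = lam ≈-refl
  ≈-refl {app M P} = app ≈-refl ≈ᵇ-refl

  ≈ʳ-refl : ∀ {r} → r ≈ʳ r
  ≈ʳ-refl {lin M} = lin ≈-refl
  ≈ʳ-refl {bang M} = bang ≈-refl

  ≈ᵇ-refl : ∀ {b} → b ≈ᵇ b
  ≈ᵇ-refl {[]} = nil
  ≈ᵇ-refl {r ∷ b} = prep ≈ʳ-refl ≈ᵇ-refl

mutual
  ≈-sym : ∀ {M N} → M ≈ N → N ≈ M
  ≈-sym var = var
  ≈-sym (lam p) = lam (≈-sym p)
  ≈-sym (app p q) = app (≈-sym p) (≈ᵇ-sym q)

  ≈ʳ-sym : ∀ {r s} → r ≈ʳ s → s ≈ʳ r
  ≈ʳ-sym (lin p) = lin (≈-sym p)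
  ≈ʳ-sym (bang p) = bang (≈-sym p)

  ≈ᵇ-sym : ∀ {b c} → b ≈ᵇ c → c ≈ᵇ b
  ≈ᵇ-sym nil = nil
  ≈ᵇ-sym (prep p q) = prep (≈ʳ-sym p) (≈ᵇ-sym q)
  ≈ᵇ-sym swap = swap
  ≈ᵇ-sym (trans p q) = trans (≈ᵇ-sym q) (≈ᵇ-sym p)

mutual
  ≈-trans : ∀ {M N O} → M ≈ N → N ≈ O → M ≈ O
  ≈-trans var var = var
  ≈-trans (lam p) (lam q) = lam (≈-trans p q)
  ≈-trans (app p q) (app p' q') = app (≈-trans p p') (trans q q')

  ≈ʳ-trans : ∀ {r s t} → r ≈ʳ s → s ≈ʳ t → r ≈ʳ t
  ≈ʳ-trans (lin p) (lin q) = lin (≈-trans p q)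
  ≈ʳ-trans (bang p) (bang q) = bang (≈-trans p q)

≈-setoid : Setoid 0ℓ 0ℓ
≈-setoid = record
  { Carrier = Term ; _≈_ = _≈_
  ; isEquivalence = record { refl = ≈-refl ; sym = ≈-sym ; trans = ≈-trans } }

≈ʳ-setoid : Setoid 0ℓ 0ℓ
≈ʳ-setoid = record
  { Carrier = Res ; _≈_ = _≈ʳ_
  ; isEquivalence = record { refl = ≈ʳ-refl ; sym = ≈ʳ-sym ; trans = ≈ʳ-trans } }

≈ᵇ-setoid : Setoid 0ℓ 0ℓ
≈ᵇ-setoid = record
  { Carrier = Bag ; _≈_ = _≈ᵇ_
  ; isEquivalence = record { refl = ≈ᵇ-refl ; sym = ≈ᵇ-sym ; trans = trans } }

module ↭ʳ where
  open Permutation ≈ʳ-setoid public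
  open PermutationProperties ≈ʳ-setoid public

≈ᵇ⇒↭ʳ : ∀ {b c} → b ≈ᵇ c → b ↭ʳ.↭ c
≈ᵇ⇒↭ʳ nil = ↭ʳ.↭-refl
≈ᵇ⇒↭ʳ (prep r p) = ↭.prep r (≈ᵇ⇒↭ʳ p)
≈ᵇ⇒↭ʳ swap = ↭ʳ.↭-swap _ _ ↭ʳ.↭-refl
≈ᵇ⇒↭ʳ (trans p q) = ↭.trans (≈ᵇ⇒↭ʳ p) (≈ᵇ⇒↭ʳ q)

↭ʳ⇒≈ᵇ : ∀ {b c} → b ↭ʳ.↭ c → b ≈ᵇ c
↭ʳ⇒≈ᵇ (↭.refl rs) = pointwise rs
  where
  pointwise : ∀ {b c} → Pointwise _≈ʳ_ b c → b ≈ᵇ c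
  pointwise Pointwise.[] = nil
  pointwise (r Pointwise.∷ rs) = prep r (pointwise rs)
↭ʳ⇒≈ᵇ (↭.prep r p) = prep r (↭ʳ⇒≈ᵇ p)
↭ʳ⇒≈ᵇ (↭.swap r s p) = trans (prep r (prep s (↭ʳ⇒≈ᵇ p))) swap
↭ʳ⇒≈ᵇ (↭.trans p q) = trans (↭ʳ⇒≈ᵇ p) (↭ʳ⇒≈ᵇ q)

≈ᵇ-++ : ∀ {b b' c c'} → b ≈ᵇ b' → c ≈ᵇ c' → (b ++ c) ≈ᵇ (b' ++ c')
≈ᵇ-++ p q = ↭ʳ⇒≈ᵇ (↭ʳ.++⁺ (≈ᵇ⇒↭ʳ p) (≈ᵇ⇒↭ʳ q))

≈ᵇ-shifts : ∀ b c e → (b ++ c ++ e) ≈ᵇ (c ++ b ++ e)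
≈ᵇ-shifts b c e = ↭ʳ⇒≈ᵇ (↭ʳ.shifts b c)

≈ᵇ-shift : ∀ r b c → (b ++ r ∷ c) ≈ᵇ (r ∷ b ++ c)
≈ᵇ-shift r b c = ↭ʳ⇒≈ᵇ (↭ʳ.↭-shift b c)

infix 4 _≈Σ_ _≈Σᵇ_

_≈Σ_ : TSum → TSum → Set
_≈Σ_ = Permutation._↭_ ≈-setoid

_≈Σᵇ_ : BSum → BSum → Set
_≈Σᵇ_ = Permutation._↭_ ≈ᵇ-setoid

module ≈Σ where
  open Permutation ≈-setoid public
  open PermutationProperties ≈-setoid public

module ≈Σᵇ where
  open Permutation ≈ᵇ-setoid public
  open PermutationProperties ≈ᵇ-setoid public

infix 4 _∈⟨_⟩_ _∈≈_ _∈≈ᵇ_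

_∈⟨_⟩_ : ∀ {A : Set} → A → (A → A → Set) → List A → Set
x ∈⟨ R ⟩ L = Σ _ λ y → y ∈ L × R x y

_∈≈_ : Term → TSum → Set
U ∈≈ S = U ∈⟨ _≈_ ⟩ S

_∈≈ᵇ_ : Bag → BSum → Set
c ∈≈ᵇ S = c ∈⟨ _≈ᵇ_ ⟩ S

∈⇒∈≈ : ∀ {U S} → U ∈ S → U ∈≈ S
∈⇒∈≈ {U} u = U , u , ≈-refl

∈⇒∈≈ᵇ : ∀ {c S} → c ∈ S → c ∈≈ᵇ S
∈⇒∈≈ᵇ {c} u = c , u , ≈ᵇ-refl

∈⟨⟩-map : ∀ {A B : Set} {R : A → A → Set} {R' : B → B → Set} (f : A → B) →
  (∀ {a b} → R a b → R' (f a) (f b)) → ∀ {x L} → x ∈⟨ R ⟩ L → f x ∈⟨ R' ⟩ map f L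
∈⟨⟩-map f t (y , p , r) = f y , ∈-map⁺ f p , t r

∈⟨⟩-respˡ : ∀ {A : Set} {R : A → A → Set} → (∀ {x y z} → R x y → R y z → R x z) →
  ∀ {x y L} → R x y → y ∈⟨ R ⟩ L → x ∈⟨ R ⟩ L
∈⟨⟩-respˡ t r (z , p , r') = z , p , t r r'

∈≈⇒∈Σ : ∀ {U S} → U ∈≈ S → U ∈Σ S
∈≈⇒∈Σ (V , v , e) = lose v e

∈≈-resp-≈Σ : ∀ {S S'} → S ≈Σ S' → ∀ {U} → U ∈≈ S → U ∈≈ S'
∈≈-resp-≈Σ p (V , v , e) = find (≈Σ.∈-resp-↭ p (lose v e))

productWith : ∀ {A B C : Set} → (A → B → C) → List A → List B → List C
productWith g X Y = concatMap (λ x → map (g x) Y) X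

module _ (S : Setoid 0ℓ 0ℓ) where
  open Setoid S using () renaming (Carrier to C)
  open Permutation S using (_↭_; ↭-trans; ↭-reflexive)

  productWith-concatMap : ∀ {A B A' B' : Set} (g : A → B → C) (f : A' → List A) (h : B' → List B) X Y →
    productWith g (concatMap f X) (concatMap h Y) ↭
    concatMap (λ x → concatMap (λ y → productWith g (f x) (h y)) Y) X
  productWith-concatMap g f h X Y =
    ↭-trans (↭-reflexive (concatMap-concatMap (λ a → map (g a) (concatMap h Y)) f X))
      (concatMap-↭-pointwise S (λ x →
        ↭-trans (↭-reflexive (concatMap-cong (λ a → map-concatMap (g a) h Y) (f x)))
                (concatMap-comm S (λ a y → map (g a) (h y)) (f x) Y)) X)

module _ (SA SB S : Setoid 0ℓ 0ℓ) where
  open Setoid SA using () renaming (Carrier to A; _≈_ to _≈A_; refl to reflA)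
  open Setoid SB using () renaming (Carrier to B; _≈_ to _≈B_; refl to reflB)
  open Setoid S using () renaming (Carrier to C; _≈_ to _≈C_)
  open Permutation SA using () renaming (_↭_ to _↭A_)
  open Permutation SB using () renaming (_↭_ to _↭B_)
  open Permutation S using (_↭_; ↭-trans)

  productWith-cong : (g : A → B → C) → (∀ {a a' b b'} → a ≈A a' → b ≈B b' → g a b ≈C g a' b') →
    ∀ {X X' Y Y'} → X ↭A X' → Y ↭B Y' → productWith g X Y ↭ productWith g X' Y'
  productWith-cong g t {X} {X'} {Y} {Y'} p q =
    ↭-trans (concatMap-↭-pointwise S (λ x → PermutationProperties.map⁺ SB S (t reflA) q) X)
            (concatMap⁺ SA S (λ {a} {a'} r → ↭.refl (Pointwise.map⁺ (g a) (g a') (Pointwise.refl (t r reflB)))) p)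

ext-cong : ∀ {ρ ρ' : Ren} → (∀ n → ρ n ≡ ρ' n) → ∀ n → ext ρ n ≡ ext ρ' n
ext-cong e zero = refl
ext-cong e (suc n) = cong suc (e n)

mutual
  rename-cong : ∀ {ρ ρ' : Ren} → (∀ n → ρ n ≡ ρ' n) → ∀ M → rename ρ M ≡ rename ρ' M
  rename-cong e (var n) = cong var (e n)
  rename-cong e (lam M) = cong lam (rename-cong (ext-cong e) M)
  rename-cong e (app M P) = cong₂ app (rename-cong e M) (renameB-cong e P)

  renameB-cong : ∀ {ρ ρ' : Ren} → (∀ n → ρ n ≡ ρ' n) → ∀ P → renameB ρ P ≡ renameB ρ' P
  renameB-cong e [] = refl
  renameB-cong e (lin M ∷ b) = cong₂ (λ x y → lin x ∷ y) (rename-cong e M) (renameB-cong e b)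
  renameB-cong e (bang M ∷ b) = cong₂ (λ x y → bang x ∷ y) (rename-cong e M) (renameB-cong e b)

mutual
  rename-∘ : ∀ (ρ ρ' : Ren) M → rename ρ (rename ρ' M) ≡ rename (ρ ∘ ρ') M
  rename-∘ ρ ρ' (var n) = refl
  rename-∘ ρ ρ' (lam M) = cong lam (≡trans (rename-∘ (ext ρ) (ext ρ') M) (rename-cong e M))
    where
    e : ∀ n → ext ρ (ext ρ' n) ≡ ext (ρ ∘ ρ') n
    e zero = refl
    e (suc n) = refl
  rename-∘ ρ ρ' (app M P) = cong₂ app (rename-∘ ρ ρ' M) (renameB-∘ ρ ρ' P)

  renameB-∘ : ∀ (ρ ρ' : Ren) P → renameB ρ (renameB ρ' P) ≡ renameB (ρ ∘ ρ') P
  renameB-∘ ρ ρ' [] = refl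
  renameB-∘ ρ ρ' (lin M ∷ b) = cong₂ (λ x y → lin x ∷ y) (rename-∘ ρ ρ' M) (renameB-∘ ρ ρ' b)
  renameB-∘ ρ ρ' (bang M ∷ b) = cong₂ (λ x y → bang x ∷ y) (rename-∘ ρ ρ' M) (renameB-∘ ρ ρ' b)

mutual
  rename-id : ∀ {ρ : Ren} → (∀ n → ρ n ≡ n) → ∀ M → rename ρ M ≡ M
  rename-id e (var n) = cong var (e n)
  rename-id {ρ} e (lam M) = cong lam (rename-id e' M)
    where
    e' : ∀ n → ext ρ n ≡ n
    e' zero = refl
    e' (suc n) = cong suc (e n)
  rename-id e (app M P) = cong₂ app (rename-id e M) (renameB-id e P)

  renameB-id : ∀ {ρ : Ren} → (∀ n → ρ n ≡ n) → ∀ P → renameB ρ P ≡ P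
  renameB-id e [] = refl
  renameB-id e (lin M ∷ b) = cong₂ (λ x y → lin x ∷ y) (rename-id e M) (renameB-id e b)
  renameB-id e (bang M ∷ b) = cong₂ (λ x y → bang x ∷ y) (rename-id e M) (renameB-id e b)

rename-ext-shift : ∀ (ρ : Ren) M → rename (ext ρ) (shift M) ≡ shift (rename ρ M)
rename-ext-shift ρ M = ≡trans (rename-∘ (ext ρ) suc M) (sym (rename-∘ suc ρ M))

exts-cong : ∀ {σ τ : SSub} → (∀ n → σ n ≡ τ n) → ∀ n → exts σ n ≡ exts τ n
exts-cong e zero = refl
exts-cong e (suc n) = cong (map shift) (e n)

mutual
  subst-cong : ∀ {σ τ : SSub} → (∀ n → σ n ≡ τ n) → ∀ M → subst σ M ≡ subst τ M
  subst-cong e (var n) = e n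
  subst-cong e (lam M) = cong (map lam) (subst-cong (exts-cong e) M)
  subst-cong {σ} {τ} e (app M P) =
    ≡trans (cong (λ z → concatMap (λ M' → map (app M') z) (subst σ M)) (substB-cong e P))
           (cong (concatMap (λ M' → map (app M') (substB τ P))) (subst-cong e M))

  substB-cong : ∀ {σ τ : SSub} → (∀ n → σ n ≡ τ n) → ∀ P → substB σ P ≡ substB τ P
  substB-cong e [] = refl
  substB-cong {σ} {τ} e (lin M ∷ b) =
    ≡trans (cong (λ z → concatMap (λ M' → map (lin M' ∷_) z) (subst σ M)) (substB-cong e b))
           (cong (concatMap (λ M' → map (lin M' ∷_) (substB τ b))) (subst-cong e M))
  substB-cong e (bang M ∷ b) = cong₂ (λ x y → map (map bang x ++_) y) (subst-cong e M) (substB-cong e b)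

mutual
  subst-rename : ∀ (σ : SSub) (ρ : Ren) M → subst σ (rename ρ M) ≡ subst (σ ∘ ρ) M
  subst-rename σ ρ (var n) = refl
  subst-rename σ ρ (lam M) = cong (map lam) (≡trans (subst-rename (exts σ) (ext ρ) M) (subst-cong e M))
    where
    e : ∀ n → exts σ (ext ρ n) ≡ exts (σ ∘ ρ) n
    e zero = refl
    e (suc n) = refl
  subst-rename σ ρ (app M P) =
    ≡trans (cong (concatMap (λ M' → map (app M') (substB σ (renameB ρ P)))) (subst-rename σ ρ M))
           (cong (λ z → concatMap (λ M' → map (app M') z) (subst (σ ∘ ρ) M)) (substB-rename σ ρ P))

  substB-rename : ∀ (σ : SSub) (ρ : Ren) P → substB σ (renameB ρ P) ≡ substB (σ ∘ ρ) P
  substB-rename σ ρ [] = refl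
  substB-rename σ ρ (lin M ∷ b) =
    ≡trans (cong (concatMap (λ M' → map (lin M' ∷_) (substB σ (renameB ρ b)))) (subst-rename σ ρ M))
           (cong (λ z → concatMap (λ M' → map (lin M' ∷_) z) (subst (σ ∘ ρ) M)) (substB-rename σ ρ b))
  substB-rename σ ρ (bang M ∷ b) = cong₂ (λ x y → map (map bang x ++_) y) (subst-rename σ ρ M) (substB-rename σ ρ b)

renameB-bangs : ∀ (ρ : Ren) L b → renameB ρ (map bang L ++ b) ≡ map bang (map (rename ρ) L) ++ renameB ρ b
renameB-bangs ρ [] b = refl
renameB-bangs ρ (M ∷ L) b = cong (bang (rename ρ M) ∷_) (renameB-bangs ρ L b)

mutual
  rename-subst : ∀ (ρ : Ren) (σ : SSub) M → map (rename ρ) (subst σ M) ≡ subst (map (rename ρ) ∘ σ) M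
  rename-subst ρ σ (var n) = refl
  rename-subst ρ σ (lam M) =
    ≡trans (sym (map-∘ (subst (exts σ) M)))
    (≡trans (map-∘ (subst (exts σ) M))
    (cong (map lam) (≡trans (rename-subst (ext ρ) (exts σ) M) (subst-cong e M))))
    where
    e : ∀ n → map (rename (ext ρ)) (exts σ n) ≡ exts (map (rename ρ) ∘ σ) n
    e zero = refl
    e (suc n) = ≡trans (sym (map-∘ (σ n)))
                (≡trans (map-cong (rename-ext-shift ρ) (σ n)) (map-∘ (σ n)))
  rename-subst ρ σ (app M P) =
    ≡trans (map-concatMap (rename ρ) (λ M' → map (app M') (substB σ P)) (subst σ M))
    (≡trans (concatMap-cong (λ M' → ≡trans (sym (map-∘ (substB σ P)))
                       (≡trans (map-∘ (substB σ P))
                               (cong (map (app (rename ρ M'))) (renameB-subst ρ σ P)))) (subst σ M))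
    (≡trans (sym (concatMap-map (λ M' → map (app M') (substB (map (rename ρ) ∘ σ) P)) (rename ρ) (subst σ M)))
            (cong (concatMap (λ M' → map (app M') (substB (map (rename ρ) ∘ σ) P))) (rename-subst ρ σ M))))

  renameB-subst : ∀ (ρ : Ren) (σ : SSub) P → map (renameB ρ) (substB σ P) ≡ substB (map (rename ρ) ∘ σ) P
  renameB-subst ρ σ [] = refl
  renameB-subst ρ σ (lin M ∷ b) =
    ≡trans (map-concatMap (renameB ρ) (λ M' → map (lin M' ∷_) (substB σ b)) (subst σ M))
    (≡trans (concatMap-cong (λ M' → ≡trans (sym (map-∘ (substB σ b)))
                       (≡trans (map-∘ (substB σ b))
                               (cong (map (lin (rename ρ M') ∷_)) (renameB-subst ρ σ b)))) (subst σ M))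
    (≡trans (sym (concatMap-map (λ M' → map (lin M' ∷_) (substB (map (rename ρ) ∘ σ) b)) (rename ρ) (subst σ M)))
            (cong (concatMap (λ M' → map (lin M' ∷_) (substB (map (rename ρ) ∘ σ) b))) (rename-subst ρ σ M))))
  renameB-subst ρ σ (bang M ∷ b) =
    ≡trans (sym (map-∘ (substB σ b)))
    (≡trans (map-cong (λ c → renameB-bangs ρ (subst σ M) c) (substB σ b))
    (≡trans (map-∘ (substB σ b))
    (cong₂ (λ x y → map (map bang x ++_) y) (rename-subst ρ σ M) (renameB-subst ρ σ b))))

mutual
  subst-renaming : ∀ {σ : SSub} {ρ : Ren} → (∀ n → σ n ≡ [ var (ρ n) ]) → ∀ M → subst σ M ≡ [ rename ρ M ]
  subst-renaming e (var n) = e n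
  subst-renaming {σ} {ρ} e (lam M) = cong (map lam) (subst-renaming e' M)
    where
    e' : ∀ n → exts σ n ≡ [ var (ext ρ n) ]
    e' zero = refl
    e' (suc n) = cong (map shift) (e n)
  subst-renaming {σ} {ρ} e (app M P) =
    ≡trans (cong (concatMap (λ M' → map (app M') (substB σ P))) (subst-renaming e M))
    (≡trans (++-identityʳ ((λ M' → map (app M') (substB σ P)) (rename ρ M)))
            (cong (map (app (rename ρ M))) (substB-renaming e P)))

  substB-renaming : ∀ {σ : SSub} {ρ : Ren} → (∀ n → σ n ≡ [ var (ρ n) ]) → ∀ P → substB σ P ≡ [ renameB ρ P ]
  substB-renaming e [] = refl
  substB-renaming {σ} {ρ} e (lin M ∷ b) =
    ≡trans (cong (concatMap (λ M' → map (lin M' ∷_) (substB σ b))) (subst-renaming e M))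
    (≡trans (++-identityʳ ((λ M' → map (lin M' ∷_) (substB σ b)) (rename ρ M)))
            (cong (map (lin (rename ρ M) ∷_)) (substB-renaming e b)))
  substB-renaming e (bang M ∷ b) = cong₂ (λ x y → map (map bang x ++_) y) (subst-renaming e M) (substB-renaming e b)

shift-subst : ∀ (τ : SSub) M → subst (exts τ) (shift M) ≡ map shift (subst τ M)
shift-subst τ M = ≡trans (subst-rename (exts τ) suc M) (sym (rename-subst suc τ M))

subst-zeroSub-shift : ∀ M → subst zeroSub (shift M) ≡ [ M ]
subst-zeroSub-shift M = ≡trans (subst-rename zeroSub suc M)
  (≡trans (subst-renaming {ρ = λ n → n} (λ n → refl) M) (cong [_] (rename-id (λ n → refl) M)))

renamingSub : Ren → SSub
renamingSub ρ n = [ var (ρ n) ]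

-- Bags are written multiplicatively: P ·ᵇ Q is the multiset union, extended bilinearly to sums.
infixr 6 _·ᵇ_

_·ᵇ_ : BSum → BSum → BSum
_·ᵇ_ = productWith _++_

substR : SSub → Res → BSum
substR σ (lin M) = map (λ M' → [ lin M' ]) (subst σ M)
substR σ (bang M) = [ map bang (subst σ M) ]

substB-∷ : ∀ σ r b → substB σ (r ∷ b) ≡ substR σ r ·ᵇ substB σ b
substB-∷ σ (lin M) b = sym (concatMap-map (λ c → map (c ++_) (substB σ b)) (λ M' → [ lin M' ]) (subst σ M))
substB-∷ σ (bang M) b = sym (++-identityʳ _)

·ᵇ-expand : ∀ C D E → C ·ᵇ (D ·ᵇ E) ≡ concatMap (λ c → concatMap (λ d → map (λ e → c ++ d ++ e) E) D) C
·ᵇ-expand C D E = concatMap-cong (λ c → ≡trans (map-concatMap (c ++_) (λ d → map (d ++_) E) D)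
                    (concatMap-cong (λ d → sym (map-∘ E)) D)) C

·ᵇ-assoc : ∀ C D E → C ·ᵇ (D ·ᵇ E) ≡ (C ·ᵇ D) ·ᵇ E
·ᵇ-assoc C D E = begin
  C ·ᵇ (D ·ᵇ E)
    ≡⟨ ·ᵇ-expand C D E ⟩
  concatMap (λ c → concatMap (λ d → map (λ e → c ++ d ++ e) E) D) C
    ≡⟨ concatMap-cong (λ c → concatMap-cong (λ d → map-cong (λ e → sym (++-assoc c d e)) E) D) C ⟩
  concatMap (λ c → concatMap (λ d → map ((c ++ d) ++_) E) D) C
    ≡⟨ concatMap-cong (λ c → concatMap-map (λ x → map (x ++_) E) (c ++_) D) C ⟨
  concatMap (λ c → concatMap (λ x → map (x ++_) E) (map (c ++_) D)) C
    ≡⟨ concatMap-concatMap (λ x → map (x ++_) E) (λ c → map (c ++_) D) C ⟨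
  (C ·ᵇ D) ·ᵇ E ∎
  where open ≡-Reasoning

·ᵇ-cong : ∀ {X X' Y Y'} → X ≈Σᵇ X' → Y ≈Σᵇ Y' → X ·ᵇ Y ≈Σᵇ X' ·ᵇ Y'
·ᵇ-cong = productWith-cong ≈ᵇ-setoid ≈ᵇ-setoid ≈ᵇ-setoid _++_ ≈ᵇ-++

·ᵇ-left-comm : ∀ C D E → C ·ᵇ (D ·ᵇ E) ≈Σᵇ D ·ᵇ (C ·ᵇ E)
·ᵇ-left-comm C D E = begin
  C ·ᵇ (D ·ᵇ E)
    ≡⟨ ·ᵇ-expand C D E ⟩
  concatMap (λ c → concatMap (λ d → map (λ e → c ++ d ++ e) E) D) C
    ↭⟨ concatMap-comm ≈ᵇ-setoid (λ c d → map (λ e → c ++ d ++ e) E) C D ⟩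
  concatMap (λ d → concatMap (λ c → map (λ e → c ++ d ++ e) E) C) D
    ↭⟨ concatMap-↭-pointwise ≈ᵇ-setoid (λ d → concatMap-↭-pointwise ≈ᵇ-setoid (λ c → shifted c d) C) D ⟩
  concatMap (λ d → concatMap (λ c → map (λ e → d ++ c ++ e) E) C) D
    ≡⟨ ·ᵇ-expand D C E ⟨
  D ·ᵇ (C ·ᵇ E) ∎
  where
  open ≈Σᵇ.PermutationReasoning
  shifted : ∀ c d → map (λ e → c ++ d ++ e) E ≈Σᵇ map (λ e → d ++ c ++ e) E
  shifted c d = ↭.refl (Pointwise.map⁺ _ _ (Pointwise.refl (λ {e} → ≈ᵇ-shifts c d e)))

mutual
  rename-≈ : ∀ (ρ : Ren) {M M'} → M ≈ M' → rename ρ M ≈ rename ρ M'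
  rename-≈ ρ var = var
  rename-≈ ρ (lam p) = lam (rename-≈ (ext ρ) p)
  rename-≈ ρ (app p q) = app (rename-≈ ρ p) (renameB-≈ ρ q)

  renameB-≈ : ∀ (ρ : Ren) {b b'} → b ≈ᵇ b' → renameB ρ b ≈ᵇ renameB ρ b'
  renameB-≈ ρ nil = nil
  renameB-≈ ρ (prep (lin p) q) = prep (lin (rename-≈ ρ p)) (renameB-≈ ρ q)
  renameB-≈ ρ (prep (bang p) q) = prep (bang (rename-≈ ρ p)) (renameB-≈ ρ q)
  renameB-≈ ρ (swap {lin M} {lin N}) = swap
  renameB-≈ ρ (swap {lin M} {bang N}) = swap
  renameB-≈ ρ (swap {bang M} {lin N}) = swap
  renameB-≈ ρ (swap {bang M} {bang N}) = swap
  renameB-≈ ρ (trans p q) = trans (renameB-≈ ρ p) (renameB-≈ ρ q)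

app-cong : ∀ {X X' Y Y'} → X ≈Σ X' → Y ≈Σᵇ Y' → productWith app X Y ≈Σ productWith app X' Y'
app-cong = productWith-cong ≈-setoid ≈ᵇ-setoid ≈-setoid app app

lam-cong : ∀ {X Y} → X ≈Σ Y → map lam X ≈Σ map lam Y
lam-cong = ≈Σ.map⁺ ≈-setoid lam

lin-cong : ∀ {X Y} → X ≈Σ Y → map (λ M → [ lin M ]) X ≈Σᵇ map (λ M → [ lin M ]) Y
lin-cong = ≈Σ.map⁺ ≈ᵇ-setoid (λ e → prep (lin e) nil)

bang-cong : ∀ {X Y} → X ≈Σ Y → [ map bang X ] ≈Σᵇ [ map bang Y ]
bang-cong p = ↭.refl (↭ʳ⇒≈ᵇ (≈Σ.map⁺ ≈ʳ-setoid bang p) Pointwise.∷ Pointwise.[])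

mutual
  subst-≈ : ∀ σ {M M'} → M ≈ M' → subst σ M ≈Σ subst σ M'
  subst-≈ σ var = ≈Σ.↭-refl
  subst-≈ σ (lam p) = lam-cong (subst-≈ (exts σ) p)
  subst-≈ σ (app p q) = app-cong (subst-≈ σ p) (substB-≈ σ q)

  substR-≈ : ∀ σ {r r'} → r ≈ʳ r' → substR σ r ≈Σᵇ substR σ r'
  substR-≈ σ (lin p) = lin-cong (subst-≈ σ p)
  substR-≈ σ (bang p) = bang-cong (subst-≈ σ p)

  substB-≈ : ∀ σ {b b'} → b ≈ᵇ b' → substB σ b ≈Σᵇ substB σ b'
  substB-≈ σ nil = ≈Σᵇ.↭-refl
  substB-≈ σ (prep {r} {r'} {b} {b'} p q) = begin
    substB σ (r ∷ b)              ≡⟨ substB-∷ σ r b ⟩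
    substR σ r ·ᵇ substB σ b      ↭⟨ ·ᵇ-cong (substR-≈ σ p) (substB-≈ σ q) ⟩
    substR σ r' ·ᵇ substB σ b'    ≡⟨ substB-∷ σ r' b' ⟨
    substB σ (r' ∷ b')            ∎
    where open ≈Σᵇ.PermutationReasoning
  substB-≈ σ (swap {r} {s} {b}) = begin
    substB σ (r ∷ s ∷ b)                         ≡⟨ ≡trans (substB-∷ σ r (s ∷ b)) (cong (substR σ r ·ᵇ_) (substB-∷ σ s b)) ⟩
    substR σ r ·ᵇ substR σ s ·ᵇ substB σ b       ↭⟨ ·ᵇ-left-comm (substR σ r) (substR σ s) (substB σ b) ⟩
    substR σ s ·ᵇ substR σ r ·ᵇ substB σ b       ≡⟨ ≡trans (substB-∷ σ s (r ∷ b)) (cong (substR σ s ·ᵇ_) (substB-∷ σ r b)) ⟨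
    substB σ (s ∷ r ∷ b)                         ∎
    where open ≈Σᵇ.PermutationReasoning
  substB-≈ σ (trans p q) = ↭.trans (substB-≈ σ p) (substB-≈ σ q)

exts-≈Σ : ∀ {σ τ} → (∀ n → σ n ≈Σ τ n) → ∀ n → exts σ n ≈Σ exts τ n
exts-≈Σ e zero = ≈Σ.↭-refl
exts-≈Σ e (suc n) = ≈Σ.map⁺ ≈-setoid (rename-≈ suc) (e n)

mutual
  subst-≈Σ : ∀ {σ τ} → (∀ n → σ n ≈Σ τ n) → ∀ M → subst σ M ≈Σ subst τ M
  subst-≈Σ e (var n) = e n
  subst-≈Σ e (lam M) = lam-cong (subst-≈Σ (exts-≈Σ e) M)
  subst-≈Σ e (app M P) = app-cong (subst-≈Σ e M) (substB-≈Σ e P)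

  substR-≈Σ : ∀ {σ τ} → (∀ n → σ n ≈Σ τ n) → ∀ r → substR σ r ≈Σᵇ substR τ r
  substR-≈Σ e (lin M) = lin-cong (subst-≈Σ e M)
  substR-≈Σ e (bang M) = bang-cong (subst-≈Σ e M)

  substB-≈Σ : ∀ {σ τ} → (∀ n → σ n ≈Σ τ n) → ∀ P → substB σ P ≈Σᵇ substB τ P
  substB-≈Σ e [] = ≈Σᵇ.↭-refl
  substB-≈Σ {σ} {τ} e (r ∷ b) = begin
    substB σ (r ∷ b)              ≡⟨ substB-∷ σ r b ⟩
    substR σ r ·ᵇ substB σ b      ↭⟨ ·ᵇ-cong (substR-≈Σ e r) (substB-≈Σ e b) ⟩
    substR τ r ·ᵇ substB τ b      ≡⟨ substB-∷ τ r b ⟨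
    substB τ (r ∷ b)              ∎
    where open ≈Σᵇ.PermutationReasoning

infixl 5 _⨾_

_⨾_ : SSub → SSub → SSub
(σ ⨾ τ) n = concatMap (subst τ) (σ n)

exts-⨾ : ∀ σ τ n → (exts σ ⨾ exts τ) n ≡ exts (σ ⨾ τ) n
exts-⨾ σ τ zero = refl
exts-⨾ σ τ (suc n) =
  ≡trans (concatMap-map (subst (exts τ)) shift (σ n))
  (≡trans (concatMap-cong (shift-subst τ) (σ n)) (sym (map-concatMap shift (subst τ) (σ n))))

substB-++ : ∀ τ c d → substB τ (c ++ d) ≡ substB τ c ·ᵇ substB τ d
substB-++ τ [] d = sym (≡trans (++-identityʳ _) (map-id (substB τ d)))
substB-++ τ (r ∷ c) d = begin
  substB τ (r ∷ c ++ d)                     ≡⟨ substB-∷ τ r (c ++ d) ⟩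
  substR τ r ·ᵇ substB τ (c ++ d)           ≡⟨ cong (substR τ r ·ᵇ_) (substB-++ τ c d) ⟩
  substR τ r ·ᵇ substB τ c ·ᵇ substB τ d    ≡⟨ ·ᵇ-assoc (substR τ r) (substB τ c) (substB τ d) ⟩
  (substR τ r ·ᵇ substB τ c) ·ᵇ substB τ d  ≡⟨ cong (_·ᵇ substB τ d) (substB-∷ τ r c) ⟨
  substB τ (r ∷ c) ·ᵇ substB τ d            ∎
  where open ≡-Reasoning

substB-bangs : ∀ τ L c → substB τ (map bang L ++ c) ≡ map (map bang (concatMap (subst τ) L) ++_) (substB τ c)
substB-bangs τ [] c = sym (map-id (substB τ c))
substB-bangs τ (M ∷ L) c =
  ≡trans (cong (map (map bang (subst τ M) ++_)) (substB-bangs τ L c))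
  (≡trans (sym (map-∘ (substB τ c)))
  (map-cong (λ e → ≡trans (sym (++-assoc (map bang (subst τ M)) _ e))
                          (cong (_++ e) (sym (map-++ bang (subst τ M) _)))) (substB τ c)))

mutual
  subst-⨾ : ∀ σ τ M → concatMap (subst τ) (subst σ M) ≈Σ subst (σ ⨾ τ) M
  subst-⨾ σ τ (var n) = ≈Σ.↭-refl
  subst-⨾ σ τ (lam M) =
    ↭.trans (≈Σ.↭-reflexive (≡trans (concatMap-map (subst τ) lam (subst (exts σ) M))
                                     (sym (map-concatMap lam (subst (exts τ)) (subst (exts σ) M)))))
    (lam-cong (↭.trans (subst-⨾ (exts σ) (exts τ) M)
                       (subst-≈Σ (λ n → ≈Σ.↭-reflexive (exts-⨾ σ τ n)) M)))
  subst-⨾ σ τ (app M P) =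
    ↭.trans (≈Σ.↭-reflexive (≡trans (concatMap-concatMap (subst τ) (λ x → map (app x) (substB σ P)) (subst σ M))
                                     (concatMap-cong (λ x → concatMap-map (subst τ) (app x) (substB σ P)) (subst σ M))))
    (≈Σ.↭-sym (↭.trans (app-cong (≈Σ.↭-sym (subst-⨾ σ τ M)) (≈Σᵇ.↭-sym (substB-⨾ σ τ P)))
                        (productWith-concatMap ≈-setoid app (subst τ) (substB τ) (subst σ M) (substB σ P))))

  substR-⨾ : ∀ σ τ r → concatMap (substB τ) (substR σ r) ≈Σᵇ substR (σ ⨾ τ) r
  substR-⨾ σ τ (lin M) =
    ↭.trans (≈Σᵇ.↭-reflexive (≡trans (concatMap-map (substB τ) (λ M' → [ lin M' ]) (subst σ M))
       (≡trans (concatMap-cong (λ M' → concatMap-singleton (λ x → [ lin x ]) (subst τ M')) (subst σ M))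
               (sym (map-concatMap (λ x → [ lin x ]) (subst τ) (subst σ M))))))
    (lin-cong (subst-⨾ σ τ M))
  substR-⨾ σ τ (bang M) =
    ↭.trans (≈Σᵇ.↭-reflexive (≡trans (++-identityʳ (substB τ (map bang (subst σ M))))
       (≡trans (cong (substB τ) (sym (++-identityʳ (map bang (subst σ M)))))
       (≡trans (substB-bangs τ (subst σ M) []) (cong [_] (++-identityʳ _))))))
    (bang-cong (subst-⨾ σ τ M))

  substB-⨾ : ∀ σ τ P → concatMap (substB τ) (substB σ P) ≈Σᵇ substB (σ ⨾ τ) P
  substB-⨾ σ τ [] = ≈Σᵇ.↭-refl
  substB-⨾ σ τ (r ∷ b) =
    ↭.trans (≈Σᵇ.↭-reflexive (≡trans (cong (concatMap (substB τ)) (substB-∷ σ r b))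
       (≡trans (concatMap-concatMap (substB τ) (λ c → map (c ++_) (substB σ b)) (substR σ r))
       (concatMap-cong (λ c → ≡trans (concatMap-map (substB τ) (c ++_) (substB σ b))
                        (concatMap-cong (λ d → substB-++ τ c d) (substB σ b))) (substR σ r)))))
    (↭.trans (≈Σᵇ.↭-sym (productWith-concatMap ≈ᵇ-setoid _++_ (substB τ) (substB τ) (substR σ r) (substB σ b)))
    (↭.trans (·ᵇ-cong (substR-⨾ σ τ r) (substB-⨾ σ τ b))
               (≈Σᵇ.↭-reflexive (sym (substB-∷ (σ ⨾ τ) r b)))))

mutual
  data Fresh : ℕ → Term → Set where
    fresh-var : ∀ {x n} → (n ≡ᵇ x) ≡ false → Fresh x (var n)
    fresh-lam : ∀ {x M} → Fresh (suc x) M → Fresh x (lam M)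
    fresh-app : ∀ {x M P} → Fresh x M → FreshB x P → Fresh x (app M P)

  data FreshB : ℕ → Bag → Set where
    fresh-[]  : ∀ {x} → FreshB x []
    fresh-lin  : ∀ {x M b} → Fresh x M → FreshB x b → FreshB x (lin M ∷ b)
    fresh-bang : ∀ {x M b} → Fresh x M → FreshB x b → FreshB x (bang M ∷ b)

mutual
  Fresh-rename : ∀ {ρ : Ren} {x x'} → (∀ n → (n ≡ᵇ x) ≡ false → (ρ n ≡ᵇ x') ≡ false) → ∀ {M} → Fresh x M → Fresh x' (rename ρ M)
  Fresh-rename h (fresh-var e) = fresh-var (h _ e)
  Fresh-rename {ρ} {x} {x'} h (fresh-lam p) = fresh-lam (Fresh-rename h' p)
    where
    h' : ∀ n → (n ≡ᵇ suc x) ≡ false → (ext ρ n ≡ᵇ suc x') ≡ false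
    h' zero e = refl
    h' (suc n) e = h n e
  Fresh-rename h (fresh-app p q) = fresh-app (Fresh-rename h p) (FreshB-rename h q)

  FreshB-rename : ∀ {ρ : Ren} {x x'} → (∀ n → (n ≡ᵇ x) ≡ false → (ρ n ≡ᵇ x') ≡ false) → ∀ {b} → FreshB x b → FreshB x' (renameB ρ b)
  FreshB-rename h fresh-[] = fresh-[]
  FreshB-rename h (fresh-lin p q) = fresh-lin (Fresh-rename h p) (FreshB-rename h q)
  FreshB-rename h (fresh-bang p q) = fresh-bang (Fresh-rename h p) (FreshB-rename h q)

mutual
  Fresh-rename-avoiding : ∀ {ρ : Ren} {x'} → (∀ n → (ρ n ≡ᵇ x') ≡ false) → ∀ M → Fresh x' (rename ρ M)
  Fresh-rename-avoiding h (var n) = fresh-var (h n)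
  Fresh-rename-avoiding {ρ} {x'} h (lam M) = fresh-lam (Fresh-rename-avoiding h' M)
    where
    h' : ∀ n → (ext ρ n ≡ᵇ suc x') ≡ false
    h' zero = refl
    h' (suc n) = h n
  Fresh-rename-avoiding h (app M P) = fresh-app (Fresh-rename-avoiding h M) (FreshB-rename-avoiding h P)

  FreshB-rename-avoiding : ∀ {ρ : Ren} {x'} → (∀ n → (ρ n ≡ᵇ x') ≡ false) → ∀ P → FreshB x' (renameB ρ P)
  FreshB-rename-avoiding h [] = fresh-[]
  FreshB-rename-avoiding h (lin M ∷ b) = fresh-lin (Fresh-rename-avoiding h M) (FreshB-rename-avoiding h b)
  FreshB-rename-avoiding h (bang M ∷ b) = fresh-bang (Fresh-rename-avoiding h M) (FreshB-rename-avoiding h b)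

Fresh-shift₀ : ∀ M → Fresh 0 (shift M)
Fresh-shift₀ M = Fresh-rename-avoiding (λ n → refl) M

Fresh-shift : ∀ {x M} → Fresh x M → Fresh (suc x) (shift M)
Fresh-shift p = Fresh-rename (λ n e → e) p

mutual
  lsub-Fresh : ∀ {x N M} → Fresh x M → lsub x N M ≡ []
  lsub-Fresh {x} {N} (fresh-var {n = n} e) rewrite e = refl
  lsub-Fresh {N = N} (fresh-lam p) rewrite lsub-Fresh {N = shift N} p = refl
  lsub-Fresh {N = N} (fresh-app p q) rewrite lsub-Fresh {N = N} p | lsubB-FreshB {N = N} q = refl

  lsubB-FreshB : ∀ {x N b} → FreshB x b → lsubB x N b ≡ []
  lsubB-FreshB fresh-[] = refl
  lsubB-FreshB {N = N} (fresh-lin p q) rewrite lsub-Fresh {N = N} p | lsubB-FreshB {N = N} q = refl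
  lsubB-FreshB {N = N} (fresh-bang p q) rewrite lsub-Fresh {N = N} p | lsubB-FreshB {N = N} q = refl

mutual
  subst-Fresh : ∀ {σ : SSub} {z} → (∀ n → (n ≡ᵇ z) ≡ false → σ n ≡ [ var n ]) → ∀ {M} → Fresh z M → subst σ M ≡ [ M ]
  subst-Fresh h (fresh-var e) = h _ e
  subst-Fresh {σ} {z} h (fresh-lam p) = cong (map lam) (subst-Fresh h' p)
    where
    h' : ∀ n → (n ≡ᵇ suc z) ≡ false → exts σ n ≡ [ var n ]
    h' zero e = refl
    h' (suc n) e = cong (map shift) (h n e)
  subst-Fresh {σ} h (fresh-app {M = M} {P = P} p q) =
    ≡trans (cong (concatMap (λ M' → map (app M') (substB σ P))) (subst-Fresh h p))
    (≡trans (++-identityʳ ((λ M' → map (app M') (substB σ P)) M)) (cong (map (app M)) (substB-FreshB h q)))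

  substB-FreshB : ∀ {σ : SSub} {z} → (∀ n → (n ≡ᵇ z) ≡ false → σ n ≡ [ var n ]) → ∀ {b} → FreshB z b → substB σ b ≡ [ b ]
  substB-FreshB h fresh-[] = refl
  substB-FreshB {σ} h (fresh-lin {M = M} {b = b} p q) =
    ≡trans (cong (concatMap (λ M' → map (lin M' ∷_) (substB σ b))) (subst-Fresh h p))
    (≡trans (++-identityʳ ((λ M' → map (lin M' ∷_) (substB σ b)) M)) (cong (map (lin M ∷_)) (substB-FreshB h q)))
  substB-FreshB h (fresh-bang p q) rewrite subst-Fresh h p | substB-FreshB h q = refl

mutual
  Fresh-lsub : ∀ {z x N M U} → Fresh z M → Fresh z N → U ∈ lsub x N M → Fresh z U
  Fresh-lsub {x = x} (fresh-var {n = n} e) nN u with n ≡ᵇ x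
  Fresh-lsub (fresh-var e) nN (here refl) | true = nN
  Fresh-lsub (fresh-var e) nN () | false
  Fresh-lsub {x = x} {N = N} (fresh-lam {M = M} p) nN u with ∈-map⁻ lam u
  ... | U0 , u0 , refl = fresh-lam (Fresh-lsub p (Fresh-shift nN) u0)
  Fresh-lsub {x = x} {N = N} (fresh-app {M = M} {P = P} p q) nN u with ∈-++⁻ (map (λ M' → app M' P) (lsub x N M)) u
  ... | inj₁ u1 with ∈-map⁻ (λ M' → app M' P) u1
  ... | U0 , u0 , refl = fresh-app (Fresh-lsub p nN u0) q
  Fresh-lsub {x = x} {N = N} (fresh-app {M = M} {P = P} p q) nN u | inj₂ u2 with ∈-map⁻ (app M) u2
  ... | c , c0 , refl = fresh-app p (FreshB-lsubB q nN c0)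

  FreshB-lsubB : ∀ {z x N b c} → FreshB z b → Fresh z N → c ∈ lsubB x N b → FreshB z c
  FreshB-lsubB fresh-[] nN ()
  FreshB-lsubB {x = x} {N = N} (fresh-lin {M = M} {b = b} p q) nN u with ∈-++⁻ (map (λ M' → lin M' ∷ b) (lsub x N M)) u
  ... | inj₁ u1 with ∈-map⁻ (λ M' → lin M' ∷ b) u1
  ... | U0 , u0 , refl = fresh-lin (Fresh-lsub p nN u0) q
  FreshB-lsubB {x = x} {N = N} (fresh-lin {M = M} {b = b} p q) nN u | inj₂ u2 with ∈-map⁻ (lin M ∷_) u2
  ... | c , c0 , refl = fresh-lin p (FreshB-lsubB q nN c0)
  FreshB-lsubB {x = x} {N = N} (fresh-bang {M = M} {b = b} p q) nN u with ∈-++⁻ (map (λ M' → lin M' ∷ bang M ∷ b) (lsub x N M)) u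
  ... | inj₁ u1 with ∈-map⁻ (λ M' → lin M' ∷ bang M ∷ b) u1
  ... | U0 , u0 , refl = fresh-lin (Fresh-lsub p nN u0) (fresh-bang p q)
  FreshB-lsubB {x = x} {N = N} (fresh-bang {M = M} {b = b} p q) nN u | inj₂ u2 with ∈-map⁻ (bang M ∷_) u2
  ... | c , c0 , refl = fresh-bang p (FreshB-lsubB q nN c0)

Preserves≡ᵇ : Ren → Set
Preserves≡ᵇ ρ = ∀ m n → (ρ m ≡ᵇ ρ n) ≡ (m ≡ᵇ n)

ext-preserves≡ᵇ : ∀ {ρ} → Preserves≡ᵇ ρ → Preserves≡ᵇ (ext ρ)
ext-preserves≡ᵇ i zero zero = refl
ext-preserves≡ᵇ i zero (suc n) = refl
ext-preserves≡ᵇ i (suc m) zero = refl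
ext-preserves≡ᵇ i (suc m) (suc n) = i m n

suc-preserves≡ᵇ : Preserves≡ᵇ suc
suc-preserves≡ᵇ m n = refl

mutual
  rename-lsub : ∀ {ρ} → Preserves≡ᵇ ρ → ∀ x N M → map (rename ρ) (lsub x N M) ≡ lsub (ρ x) (rename ρ N) (rename ρ M)
  rename-lsub {ρ} i x N (var y) rewrite i y x with y ≡ᵇ x
  ... | true = refl
  ... | false = refl
  rename-lsub {ρ} i x N (lam M) =
    ≡trans (map-∘-comm (λ _ → refl) (lsub (suc x) (shift N) M))
    (cong (map lam) (≡trans (rename-lsub (ext-preserves≡ᵇ i) (suc x) (shift N) M)
                            (cong (λ z → lsub (suc (ρ x)) z (rename (ext ρ) M)) (rename-ext-shift ρ N))))
  rename-lsub {ρ} i x N (app M P) =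
    ≡trans (map-++ (rename ρ) (map (λ M' → app M' P) (lsub x N M)) _)
    (cong₂ _++_
      (≡trans (map-∘-comm {f' = λ M' → app M' (renameB ρ P)} (λ _ → refl) (lsub x N M))
              (cong (map (λ M' → app M' (renameB ρ P))) (rename-lsub i x N M)))
      (≡trans (map-∘-comm {f' = app (rename ρ M)} (λ _ → refl) (lsubB x N P))
              (cong (map (app (rename ρ M))) (renameB-lsubB i x N P))))

  renameB-lsubB : ∀ {ρ} → Preserves≡ᵇ ρ → ∀ x N P → map (renameB ρ) (lsubB x N P) ≡ lsubB (ρ x) (rename ρ N) (renameB ρ P)
  renameB-lsubB i x N [] = refl
  renameB-lsubB {ρ} i x N (lin M ∷ b) =
    ≡trans (map-++ (renameB ρ) (map (λ M' → lin M' ∷ b) (lsub x N M)) _)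
    (cong₂ _++_
      (≡trans (map-∘-comm {f' = λ M' → lin M' ∷ renameB ρ b} (λ _ → refl) (lsub x N M))
              (cong (map (λ M' → lin M' ∷ renameB ρ b)) (rename-lsub i x N M)))
      (≡trans (map-∘-comm {f' = lin (rename ρ M) ∷_} (λ _ → refl) (lsubB x N b))
              (cong (map (lin (rename ρ M) ∷_)) (renameB-lsubB i x N b))))
  renameB-lsubB {ρ} i x N (bang M ∷ b) =
    ≡trans (map-++ (renameB ρ) (map (λ M' → lin M' ∷ bang M ∷ b) (lsub x N M)) _)
    (cong₂ _++_
      (≡trans (map-∘-comm {f' = λ M' → lin M' ∷ bang (rename ρ M) ∷ renameB ρ b} (λ _ → refl) (lsub x N M))
              (cong (map (λ M' → lin M' ∷ bang (rename ρ M) ∷ renameB ρ b)) (rename-lsub i x N M)))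
      (≡trans (map-∘-comm {f' = bang (rename ρ M) ∷_} (λ _ → refl) (lsubB x N b))
              (cong (map (bang (rename ρ M) ∷_)) (renameB-lsubB i x N b))))

lsub-shift : ∀ x N M → lsub (suc x) (shift N) (shift M) ≡ map shift (lsub x N M)
lsub-shift x N M = sym (rename-lsub suc-preserves≡ᵇ x N M)

_⊑_ : TSum → TSum → Set
S ⊑ S' = ∀ {U} → U ∈ S → U ∈≈ S'

_⊑ᵇ_ : BSum → BSum → Set
S ⊑ᵇ S' = ∀ {U} → U ∈ S → U ∈≈ᵇ S'

∈≈-⊑ : ∀ {S S'} → S ⊑ S' → ∀ {U} → U ∈≈ S → U ∈≈ S'
∈≈-⊑ f (V , v , e) with f v
... | W , w , e' = W , w , ≈-trans e e'

∈≈ᵇ-⊑ : ∀ {S S'} → S ⊑ᵇ S' → ∀ {U} → U ∈≈ᵇ S → U ∈≈ᵇ S'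
∈≈ᵇ-⊑ f (V , v , e) with f v
... | W , w , e' = W , w , trans e e'

lsubR : ℕ → Term → Res → BSum
lsubR x N (lin M) = map (λ X → [ lin X ]) (lsub x N M)
lsubR x N (bang M) = map (λ X → lin X ∷ bang M ∷ []) (lsub x N M)

lsubB-∷ : ∀ x N r b → lsubB x N (r ∷ b) ≡ map (_++ b) (lsubR x N r) ++ map (r ∷_) (lsubB x N b)
lsubB-∷ x N (lin M) b = cong (_++ map (lin M ∷_) (lsubB x N b)) (map-∘ (lsub x N M))
lsubB-∷ x N (bang M) b = cong (_++ map (bang M ∷_) (lsubB x N b)) (map-∘ (lsub x N M))

∈-lsubB-∷⁻ : ∀ {x N r b c} → c ∈ lsubB x N (r ∷ b) →
  (Σ Bag λ d → d ∈ lsubR x N r × c ≡ d ++ b) ⊎ (Σ Bag λ c' → c' ∈ lsubB x N b × c ≡ r ∷ c')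
∈-lsubB-∷⁻ {x} {N} {r} {b} u with ∈-++⁻ (map (_++ b) (lsubR x N r)) (≡subst (_ ∈_) (lsubB-∷ x N r b) u)
... | inj₁ u1 with ∈-map⁻ (_++ b) u1
... | d , d0 , e = inj₁ (d , d0 , e)
∈-lsubB-∷⁻ {x} {N} {r} {b} u | inj₂ u2 with ∈-map⁻ (r ∷_) u2
... | c' , c0 , e = inj₂ (c' , c0 , e)

∈-lsubB-∷⁺ˡ : ∀ x N r {b d} → d ∈ lsubR x N r → (d ++ b) ∈ lsubB x N (r ∷ b)
∈-lsubB-∷⁺ˡ x N r {b} {d} u = ≡subst ((d ++ b) ∈_) (sym (lsubB-∷ x N r b)) (∈-++⁺ˡ (∈-map⁺ (_++ b) u))

∈-lsubB-∷⁺ʳ : ∀ x N r {b c} → c ∈ lsubB x N b → (r ∷ c) ∈ lsubB x N (r ∷ b)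
∈-lsubB-∷⁺ʳ x N r {b} {c} u = ≡subst ((r ∷ c) ∈_) (sym (lsubB-∷ x N r b)) (∈-++⁺ʳ (map (_++ b) (lsubR x N r)) (∈-map⁺ (r ∷_) u))

lam-∈≈ : ∀ {U L} → U ∈≈ L → lam U ∈≈ map lam L
lam-∈≈ = ∈⟨⟩-map {R = _≈_} {R' = _≈_} lam lam

mutual
  lsub-≈-body : ∀ {x N M M'} → M ≈ M' → lsub x N M ⊑ lsub x N M'
  lsub-≈-body var u = ∈⇒∈≈ u
  lsub-≈-body {x} {N} (lam {M} {M'} e) u with ∈-map⁻ lam u
  ... | U0 , u0 , refl = lam-∈≈ (lsub-≈-body e u0)
  lsub-≈-body {x} {N} (app {M} {M'} {P} {P'} e1 e2) u with ∈-++⁻ (map (λ M'' → app M'' P) (lsub x N M)) u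
  ... | inj₁ u1 with ∈-map⁻ (λ M'' → app M'' P) u1
  ... | U0 , u0 , refl with lsub-≈-body {x} {N} e1 u0
  ... | V , v , r = app V P' , ∈-++⁺ˡ (∈-map⁺ (λ M'' → app M'' P') v) , app r e2
  lsub-≈-body {x} {N} (app {M} {M'} {P} {P'} e1 e2) u | inj₂ u2 with ∈-map⁻ (app M) u2
  ... | c , c0 , refl with lsubB-≈-body {x} {N} e2 c0
  ... | d , dd , r = app M' d , ∈-++⁺ʳ (map (λ M'' → app M'' P') (lsub x N M')) (∈-map⁺ (app M') dd) , app e1 r

  lsubR-≈-body : ∀ {x N r r'} → r ≈ʳ r' → lsubR x N r ⊑ᵇ lsubR x N r'
  lsubR-≈-body {x} {N} (lin {M} {M'} e) u with ∈-map⁻ (λ X → [ lin X ]) u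
  ... | X , xx , refl with lsub-≈-body {x} {N} e xx
  ... | Y , yy , r = [ lin Y ] , ∈-map⁺ (λ X → [ lin X ]) yy , prep (lin r) nil
  lsubR-≈-body {x} {N} (bang {M} {M'} e) u with ∈-map⁻ (λ X → lin X ∷ bang M ∷ []) u
  ... | X , xx , refl with lsub-≈-body {x} {N} e xx
  ... | Y , yy , r = lin Y ∷ bang M' ∷ [] , ∈-map⁺ (λ X → lin X ∷ bang M' ∷ []) yy , prep (lin r) (prep (bang e) nil)

  lsubB-≈-body : ∀ {x N b b'} → b ≈ᵇ b' → lsubB x N b ⊑ᵇ lsubB x N b'
  lsubB-≈-body nil ()
  lsubB-≈-body {x} {N} (prep {r} {r'} {b} {b'} e1 e2) u with ∈-lsubB-∷⁻ {x} {N} {r} {b} u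
  ... | inj₁ (d , dd , refl) with lsubR-≈-body {x} {N} e1 dd
  ... | d' , dd' , q = d' ++ b' , ∈-lsubB-∷⁺ˡ x N r' dd' , ≈ᵇ-++ q e2
  lsubB-≈-body {x} {N} (prep {r} {r'} {b} {b'} e1 e2) u | inj₂ (c , cc , refl) with lsubB-≈-body {x} {N} e2 cc
  ... | c' , cc' , q = r' ∷ c' , ∈-lsubB-∷⁺ʳ x N r' cc' , prep e1 q
  lsubB-≈-body {x} {N} (swap {r} {s} {b}) u with ∈-lsubB-∷⁻ {x} {N} {r} {s ∷ b} u
  ... | inj₁ (d , dd , refl) = s ∷ d ++ b , ∈-lsubB-∷⁺ʳ x N s (∈-lsubB-∷⁺ˡ x N r dd) , ≈ᵇ-shift s d b
  ... | inj₂ (c , cc , refl) with ∈-lsubB-∷⁻ {x} {N} {s} {b} cc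
  ... | inj₁ (d , dd , refl) = d ++ r ∷ b , ∈-lsubB-∷⁺ˡ x N s dd , ≈ᵇ-sym (≈ᵇ-shift r d b)
  ... | inj₂ (c' , cc' , refl) = s ∷ r ∷ c' , ∈-lsubB-∷⁺ʳ x N s (∈-lsubB-∷⁺ʳ x N r cc') , swap
  lsubB-≈-body (trans e e') u = ∈≈ᵇ-⊑ (lsubB-≈-body e') (lsubB-≈-body e u)

mutual
  lsub-≈-arg : ∀ {x N N'} → N ≈ N' → ∀ M → lsub x N M ⊑ lsub x N' M
  lsub-≈-arg {x} e (var y) u with y ≡ᵇ x
  lsub-≈-arg {x} e (var y) (here refl) | true = _ , here refl , e
  lsub-≈-arg {x} e (var y) () | false
  lsub-≈-arg {x} {N} e (lam M) u with ∈-map⁻ lam u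
  ... | U0 , u0 , refl = lam-∈≈ (lsub-≈-arg (rename-≈ suc e) M u0)
  lsub-≈-arg {x} {N} {N'} e (app M P) u with ∈-++⁻ (map (λ M'' → app M'' P) (lsub x N M)) u
  ... | inj₁ u1 with ∈-map⁻ (λ M'' → app M'' P) u1
  ... | U0 , u0 , refl with lsub-≈-arg {x} e M u0
  ... | V , v , r = app V P , ∈-++⁺ˡ (∈-map⁺ (λ M'' → app M'' P) v) , app r ≈ᵇ-refl
  lsub-≈-arg {x} {N} {N'} e (app M P) u | inj₂ u2 with ∈-map⁻ (app M) u2
  ... | c , c0 , refl with lsubB-≈-arg {x} e P c0
  ... | d , dd , r = app M d , ∈-++⁺ʳ (map (λ M'' → app M'' P) (lsub x N' M)) (∈-map⁺ (app M) dd) , app ≈-refl r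

  lsubR-≈-arg : ∀ {x N N'} → N ≈ N' → ∀ r → lsubR x N r ⊑ᵇ lsubR x N' r
  lsubR-≈-arg {x} {N} e (lin M) u with ∈-map⁻ (λ X → [ lin X ]) u
  ... | X , xx , refl with lsub-≈-arg {x} e M xx
  ... | Y , yy , r = [ lin Y ] , ∈-map⁺ (λ X → [ lin X ]) yy , prep (lin r) nil
  lsubR-≈-arg {x} {N} e (bang M) u with ∈-map⁻ (λ X → lin X ∷ bang M ∷ []) u
  ... | X , xx , refl with lsub-≈-arg {x} e M xx
  ... | Y , yy , r = lin Y ∷ bang M ∷ [] , ∈-map⁺ (λ X → lin X ∷ bang M ∷ []) yy , prep (lin r) ≈ᵇ-refl

  lsubB-≈-arg : ∀ {x N N'} → N ≈ N' → ∀ b → lsubB x N b ⊑ᵇ lsubB x N' b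
  lsubB-≈-arg e [] ()
  lsubB-≈-arg {x} {N} {N'} e (r ∷ b) u with ∈-lsubB-∷⁻ {x} {N} {r} {b} u
  ... | inj₁ (d , dd , refl) with lsubR-≈-arg {x} e r dd
  ... | d' , dd' , q = d' ++ b , ∈-lsubB-∷⁺ˡ x N' r dd' , ≈ᵇ-++ q ≈ᵇ-refl
  lsubB-≈-arg {x} {N} {N'} e (r ∷ b) u | inj₂ (c , cc , refl) with lsubB-≈-arg {x} e b cc
  ... | c' , cc' , q = r ∷ c' , ∈-lsubB-∷⁺ʳ x N' r cc' , prep ≈ʳ-refl q

lsub-≈ : ∀ {x N N' M M'} → N ≈ N' → M ≈ M' → lsub x N M ⊑ lsub x N' M'
lsub-≈ {M = M} eN eM u = ∈≈-⊑ (lsub-≈-body eM) (lsub-≈-arg eN M u)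

subst-≈-⊑ : ∀ σ {M M'} → M ≈ M' → subst σ M ⊑ subst σ M'
subst-≈-⊑ σ e u = ∈≈-resp-≈Σ (subst-≈ σ e) (∈⇒∈≈ u)

subst-≈Σ-⊑ : ∀ {σ τ} → (∀ n → σ n ≈Σ τ n) → ∀ M → subst σ M ⊑ subst τ M
subst-≈Σ-⊑ e M u = ∈≈-resp-≈Σ (subst-≈Σ e M) (∈⇒∈≈ u)

-- Summands of the substitutions as inductive relations, which are easier to invert than
-- list membership

mutual
  data LinSub : ℕ → Term → Term → Term → Set where
    ls-var : ∀ {x N z} → (z ≡ᵇ x) ≡ true → LinSub x N (var z) N
    ls-lam : ∀ {x N M U} → LinSub (suc x) (shift N) M U → LinSub x N (lam M) (lam U)
    ls-fun : ∀ {x N M P U} → LinSub x N M U → LinSub x N (app M P) (app U P)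
    ls-arg : ∀ {x N M P c} → LinSubB x N P c → LinSub x N (app M P) (app M c)

  data LinSubB : ℕ → Term → Bag → Bag → Set where
    lsb-lin  : ∀ {x N M b X} → LinSub x N M X → LinSubB x N (lin M ∷ b) (lin X ∷ b)
    lsb-bang : ∀ {x N M b X} → LinSub x N M X → LinSubB x N (bang M ∷ b) (lin X ∷ bang M ∷ b)
    lsb-tl   : ∀ {x N r b c} → LinSubB x N b c → LinSubB x N (r ∷ b) (r ∷ c)

mutual
  LinSub⇒∈ : ∀ {x N M U} → LinSub x N M U → U ∈ lsub x N M
  LinSub⇒∈ (ls-var e) rewrite e = here refl
  LinSub⇒∈ (ls-lam p) = ∈-map⁺ lam (LinSub⇒∈ p)
  LinSub⇒∈ (ls-fun {P = P} p) = ∈-++⁺ˡ (∈-map⁺ (λ M' → app M' P) (LinSub⇒∈ p))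
  LinSub⇒∈ {x} {N} (ls-arg {M = M} {P = P} q) = ∈-++⁺ʳ (map (λ M' → app M' P) (lsub x N M)) (∈-map⁺ (app M) (LinSubB⇒∈ q))

  LinSubB⇒∈ : ∀ {x N b c} → LinSubB x N b c → c ∈ lsubB x N b
  LinSubB⇒∈ (lsb-lin {b = b} p) = ∈-++⁺ˡ (∈-map⁺ (λ M' → lin M' ∷ b) (LinSub⇒∈ p))
  LinSubB⇒∈ (lsb-bang {M = M} {b = b} p) = ∈-++⁺ˡ (∈-map⁺ (λ M' → lin M' ∷ bang M ∷ b) (LinSub⇒∈ p))
  LinSubB⇒∈ {x} {N} (lsb-tl {r = r} {b = b} q) = ∈-lsubB-∷⁺ʳ x N r (LinSubB⇒∈ q)

mutual
  ∈⇒LinSub : ∀ {x N} M {U} → U ∈ lsub x N M → LinSub x N M U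
  ∈⇒LinSub {x} {N} (var z) u with z ≡ᵇ x in e
  ∈⇒LinSub {x} {N} (var z) (here refl) | true = ls-var e
  ∈⇒LinSub {x} {N} (var z) () | false
  ∈⇒LinSub {x} {N} (lam M) u with ∈-map⁻ lam u
  ... | U0 , u0 , refl = ls-lam (∈⇒LinSub M u0)
  ∈⇒LinSub {x} {N} (app M P) u with ∈-++⁻ (map (λ M' → app M' P) (lsub x N M)) u
  ... | inj₁ u1 with ∈-map⁻ (λ M' → app M' P) u1
  ... | U0 , u0 , refl = ls-fun (∈⇒LinSub M u0)
  ∈⇒LinSub {x} {N} (app M P) u | inj₂ u2 with ∈-map⁻ (app M) u2
  ... | c , c0 , refl = ls-arg (∈⇒LinSubB P c0)

  ∈⇒LinSubB : ∀ {x N} b {c} → c ∈ lsubB x N b → LinSubB x N b c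
  ∈⇒LinSubB [] ()
  ∈⇒LinSubB {x} {N} (lin M ∷ b) u with ∈-++⁻ (map (λ M' → lin M' ∷ b) (lsub x N M)) u
  ... | inj₁ u1 with ∈-map⁻ (λ M' → lin M' ∷ b) u1
  ... | X , xx , refl = lsb-lin (∈⇒LinSub M xx)
  ∈⇒LinSubB {x} {N} (lin M ∷ b) u | inj₂ u2 with ∈-map⁻ (lin M ∷_) u2
  ... | c , cc , refl = lsb-tl (∈⇒LinSubB b cc)
  ∈⇒LinSubB {x} {N} (bang M ∷ b) u with ∈-++⁻ (map (λ M' → lin M' ∷ bang M ∷ b) (lsub x N M)) u
  ... | inj₁ u1 with ∈-map⁻ (λ M' → lin M' ∷ bang M ∷ b) u1
  ... | X , xx , refl = lsb-bang (∈⇒LinSub M xx)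
  ∈⇒LinSubB {x} {N} (bang M ∷ b) u | inj₂ u2 with ∈-map⁻ (bang M ∷_) u2
  ... | c , cc , refl = lsb-tl (∈⇒LinSubB b cc)

mutual
  data ParSub (σ : SSub) : Term → Term → Set where
    ps-var : ∀ {n U} → U ∈ σ n → ParSub σ (var n) U
    ps-lam : ∀ {M U} → ParSub (exts σ) M U → ParSub σ (lam M) (lam U)
    ps-app : ∀ {M P U c} → ParSub σ M U → ParSubB σ P c → ParSub σ (app M P) (app U c)

  data ParSubB (σ : SSub) : Bag → Bag → Set where
    psb-[]  : ParSubB σ [] []
    psb-lin  : ∀ {M b X c} → ParSub σ M X → ParSubB σ b c → ParSubB σ (lin M ∷ b) (lin X ∷ c)
    psb-bang : ∀ {M b c} → ParSubB σ b c → ParSubB σ (bang M ∷ b) (map bang (subst σ M) ++ c)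

mutual
  ParSub⇒∈ : ∀ {σ M U} → ParSub σ M U → U ∈ subst σ M
  ParSub⇒∈ (ps-var u) = u
  ParSub⇒∈ (ps-lam p) = ∈-map⁺ lam (ParSub⇒∈ p)
  ParSub⇒∈ {σ} (ps-app {P = P} {c = c} p q) = ∈-concatMap⁺′ (λ M' → map (app M') (substB σ P)) (ParSub⇒∈ p) (∈-map⁺ (app _) (ParSubB⇒∈ q))

  ParSubB⇒∈ : ∀ {σ b c} → ParSubB σ b c → c ∈ substB σ b
  ParSubB⇒∈ psb-[] = here refl
  ParSubB⇒∈ {σ} (psb-lin {b = b} p q) = ∈-concatMap⁺′ (λ M' → map (lin M' ∷_) (substB σ b)) (ParSub⇒∈ p) (∈-map⁺ (lin _ ∷_) (ParSubB⇒∈ q))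
  ParSubB⇒∈ {σ} (psb-bang {M = M} q) = ∈-map⁺ (map bang (subst σ M) ++_) (ParSubB⇒∈ q)

mutual
  ∈⇒ParSub : ∀ {σ} M {U} → U ∈ subst σ M → ParSub σ M U
  ∈⇒ParSub (var n) u = ps-var u
  ∈⇒ParSub {σ} (lam M) u with ∈-map⁻ lam u
  ... | U0 , u0 , refl = ps-lam (∈⇒ParSub M u0)
  ∈⇒ParSub {σ} (app M P) u with ∈-concatMap⁻′ (λ M' → map (app M') (substB σ P)) (subst σ M) u
  ... | U0 , u0 , u1 with ∈-map⁻ (app U0) u1
  ... | c , cc , refl = ps-app (∈⇒ParSub M u0) (∈⇒ParSubB P cc)

  ∈⇒ParSubB : ∀ {σ} b {c} → c ∈ substB σ b → ParSubB σ b c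
  ∈⇒ParSubB [] (here refl) = psb-[]
  ∈⇒ParSubB [] (there ())
  ∈⇒ParSubB {σ} (lin M ∷ b) u with ∈-concatMap⁻′ (λ M' → map (lin M' ∷_) (substB σ b)) (subst σ M) u
  ... | X , xx , u1 with ∈-map⁻ (lin X ∷_) u1
  ... | c , cc , refl = psb-lin (∈⇒ParSub M xx) (∈⇒ParSubB b cc)
  ∈⇒ParSubB {σ} (bang M ∷ b) u with ∈-map⁻ (map bang (subst σ M) ++_) u
  ... | c , cc , refl = psb-bang (∈⇒ParSubB b cc)

LinSub-shift⁻ : ∀ {x N Q Q'} → LinSub (suc x) (shift N) (shift Q) Q' → Σ Term λ Q'' → LinSub x N Q Q'' × Q' ≡ shift Q''
LinSub-shift⁻ {x} {N} {Q} {Q'} p with ∈-map⁻ shift (≡subst (Q' ∈_) (lsub-shift x N Q) (LinSub⇒∈ p))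
... | Q'' , q , e = Q'' , ∈⇒LinSub Q q , e

-- Commuting substitutions

-- The occurrence of x replaced by N lies either in B or in the copy of Q substituted for y.
data LinSubComm (x : ℕ) (N : Term) (y : ℕ) (Q : Term) (B : Term) (W : Term) : Set where
  comm-body : ∀ {X} → LinSub x N B X → LinSub y Q X W → LinSubComm x N y Q B W
  comm-arg : ∀ {Q'} → LinSub x N Q Q' → LinSub y Q' B W → LinSubComm x N y Q B W

data LinSubCommB (x : ℕ) (N : Term) (y : ℕ) (Q : Term) (b : Bag) (d : Bag) : Set where
  commB-body : ∀ {e} → LinSubB x N b e → LinSubB y Q e d → LinSubCommB x N y Q b d
  commB-arg : ∀ {Q'} → LinSub x N Q Q' → LinSubB y Q' b d → LinSubCommB x N y Q b d

mutual
  linSub-comm : ∀ {x N y Q B V U} → Fresh y N → LinSub y Q B V → LinSub x N V U → Σ Term λ W → LinSubComm x N y Q B W × U ≈ W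
  linSub-comm nN (ls-var e) u = _ , comm-arg u (ls-var e) , ≈-refl
  linSub-comm nN (ls-lam v) (ls-lam u) with linSub-comm (Fresh-shift nN) v u
  ... | W , comm-body xx ww , r = lam W , comm-body (ls-lam xx) (ls-lam ww) , lam r
  ... | W , comm-arg qq ww , r with LinSub-shift⁻ qq
  ... | Q'' , qq' , refl = lam W , comm-arg qq' (ls-lam ww) , lam r
  linSub-comm nN (ls-fun v) (ls-fun u) with linSub-comm nN v u
  ... | W , comm-body xx ww , r = _ , comm-body (ls-fun xx) (ls-fun ww) , app r ≈ᵇ-refl
  ... | W , comm-arg qq ww , r = _ , comm-arg qq (ls-fun ww) , app r ≈ᵇ-refl
  linSub-comm nN (ls-fun v) (ls-arg c) = _ , comm-body (ls-arg c) (ls-fun v) , ≈-refl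
  linSub-comm nN (ls-arg c) (ls-fun u) = _ , comm-body (ls-fun u) (ls-arg c) , ≈-refl
  linSub-comm nN (ls-arg c) (ls-arg c') with linSubB-comm nN c c'
  ... | d , commB-body ee dd , r = _ , comm-body (ls-arg ee) (ls-arg dd) , app ≈-refl r
  ... | d , commB-arg qq dd , r = _ , comm-arg qq (ls-arg dd) , app ≈-refl r

  linSubB-comm : ∀ {x N y Q b c c'} → Fresh y N → LinSubB y Q b c → LinSubB x N c c' → Σ Bag λ d → LinSubCommB x N y Q b d × c' ≈ᵇ d
  linSubB-comm nN (lsb-lin xx) (lsb-lin xx') with linSub-comm nN xx xx'
  ... | W , comm-body zz ww , r = _ , commB-body (lsb-lin zz) (lsb-lin ww) , prep (lin r) ≈ᵇ-refl
  ... | W , comm-arg qq ww , r = _ , commB-arg qq (lsb-lin ww) , prep (lin r) ≈ᵇ-refl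
  linSubB-comm nN (lsb-lin xx) (lsb-tl bb) = _ , commB-body (lsb-tl bb) (lsb-lin xx) , ≈ᵇ-refl
  linSubB-comm nN (lsb-bang xx) (lsb-lin xx') with linSub-comm nN xx xx'
  ... | W , comm-body zz ww , r = _ , commB-body (lsb-bang zz) (lsb-lin ww) , prep (lin r) ≈ᵇ-refl
  ... | W , comm-arg qq ww , r = _ , commB-arg qq (lsb-bang ww) , prep (lin r) ≈ᵇ-refl
  linSubB-comm nN (lsb-bang xx) (lsb-tl (lsb-bang yy)) = _ , commB-body (lsb-bang yy) (lsb-tl (lsb-bang xx)) , swap
  linSubB-comm nN (lsb-bang xx) (lsb-tl (lsb-tl bb)) = _ , commB-body (lsb-tl bb) (lsb-bang xx) , ≈ᵇ-refl
  linSubB-comm nN (lsb-tl cc) (lsb-lin xx) = _ , commB-body (lsb-lin xx) (lsb-tl cc) , ≈ᵇ-refl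
  linSubB-comm nN (lsb-tl cc) (lsb-bang xx) = _ , commB-body (lsb-bang xx) (lsb-tl (lsb-tl cc)) , ≈ᵇ-refl
  linSubB-comm nN (lsb-tl cc) (lsb-tl cc') with linSubB-comm nN cc cc'
  ... | d , commB-body ee dd , r = _ , commB-body (lsb-tl ee) (lsb-tl dd) , prep ≈ʳ-refl r
  ... | d , commB-arg qq dd , r = _ , commB-arg qq (lsb-tl dd) , prep ≈ʳ-refl r

bangSub : ℕ → Term → SSub
bangSub z Q n = if n ≡ᵇ z then Q ∷ var n ∷ [] else [ var n ]

exts-bangSub : ∀ z Q n → exts (bangSub z Q) n ≡ bangSub (suc z) (shift Q) n
exts-bangSub z Q zero = refl
exts-bangSub z Q (suc n) with n ≡ᵇ z
... | true = refl
... | false = refl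

ParSub-cong : ∀ {σ τ} → (∀ n → σ n ≡ τ n) → ∀ {M U} → ParSub σ M U → ParSub τ M U
ParSub-cong e {M} {U} p = ∈⇒ParSub M (≡subst (U ∈_) (subst-cong e M) (ParSub⇒∈ p))

Fresh⇒¬LinSub : ∀ {x N M U} → Fresh x M → LinSub x N M U → ⊥
Fresh⇒¬LinSub {x} {N} {M} {U} nv p with ≡subst (U ∈_) (lsub-Fresh {N = N} nv) (LinSub⇒∈ p)
... | ()

bangSub-Fresh : ∀ z Q n → (n ≡ᵇ z) ≡ false → bangSub z Q n ≡ [ var n ]
bangSub-Fresh z Q n e rewrite e = refl

Fresh-ParSub-bangSub : ∀ {z Q M W} → Fresh z M → ParSub (bangSub z Q) M W → W ≡ M
Fresh-ParSub-bangSub {z} {Q} {M} {W} nv p with ≡subst (W ∈_) (subst-Fresh (bangSub-Fresh z Q) nv) (ParSub⇒∈ p)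
... | here e = e

Fresh⇒ParSub-bangSub : ∀ {z Q M} → Fresh z M → ParSub (bangSub z Q) M M
Fresh⇒ParSub-bangSub {z} {Q} {M} nv = ∈⇒ParSub M (≡subst (M ∈_) (sym (subst-Fresh (bangSub-Fresh z Q) nv)) (here refl))

LinSubB-++ˡ : ∀ {x N} d {b c} → LinSubB x N b c → LinSubB x N (d ++ b) (d ++ c)
LinSubB-++ˡ [] p = p
LinSubB-++ˡ (r ∷ d) p = lsb-tl (LinSubB-++ˡ d p)

LinSubB-bangs⁻ : ∀ {y N} L c0 {c'} → LinSubB y N (map bang L ++ c0) c' →
  (Σ Term λ Mi → Mi ∈ L × Σ Term λ X → LinSub y N Mi X × c' ≈ᵇ (lin X ∷ map bang L ++ c0)) ⊎
  (Σ Bag λ c1 → LinSubB y N c0 c1 × c' ≡ map bang L ++ c1)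
LinSubB-bangs⁻ [] c0 p = inj₂ (_ , p , refl)
LinSubB-bangs⁻ (M ∷ L) c0 (lsb-bang xx) = inj₁ (M , here refl , _ , xx , ≈ᵇ-refl)
LinSubB-bangs⁻ (M ∷ L) c0 (lsb-tl p) with LinSubB-bangs⁻ L c0 p
... | inj₁ (Mi , mi , X , xx , r) = inj₁ (Mi , there mi , X , xx , trans (prep ≈ʳ-refl r) swap)
... | inj₂ (c1 , cc , refl) = inj₂ (c1 , cc , refl)

LinSubB-bangs⁺ : ∀ {y N} L c0 {Mi X} → Mi ∈ L → LinSub y N Mi X →
  Σ Bag λ c' → LinSubB y N (map bang L ++ c0) c' × c' ≈ᵇ (lin X ∷ map bang L ++ c0)
LinSubB-bangs⁺ (M ∷ L) c0 (here refl) xx = _ , lsb-bang xx , ≈ᵇ-refl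
LinSubB-bangs⁺ (M ∷ L) c0 (there mi) xx with LinSubB-bangs⁺ L c0 mi xx
... | c' , p , r = bang M ∷ c' , lsb-tl p , trans (prep ≈ʳ-refl r) swap

-- A summand of A⟨Q^!/z⟩⟨N/y⟩: N replaces an occurrence either in A itself or in one copy of Q,
-- and that modified copy is then a linear resource substituted for z.
data LinSubAfterBang (y : ℕ) (N : Term) (z : ℕ) (Q : Term) (A : Term) (W : Term) : Set where
  after-body : ∀ {X} → LinSub y N A X → ParSub (bangSub z Q) X W → LinSubAfterBang y N z Q A W
  after-arg : ∀ {S X} → LinSub y N Q S → LinSub z S A X → ParSub (bangSub z Q) X W → LinSubAfterBang y N z Q A W

data LinSubAfterBangB (y : ℕ) (N : Term) (z : ℕ) (Q : Term) (b : Bag) (d : Bag) : Set where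
  afterB-body : ∀ {e} → LinSubB y N b e → ParSubB (bangSub z Q) e d → LinSubAfterBangB y N z Q b d
  afterB-arg : ∀ {S e} → LinSub y N Q S → LinSubB z S b e → ParSubB (bangSub z Q) e d → LinSubAfterBangB y N z Q b d

∈-bangSub-var⁻ : ∀ {z Q n V} → V ∈ bangSub z Q n → ((n ≡ᵇ z) ≡ true × (V ≡ Q ⊎ V ≡ var n)) ⊎ ((n ≡ᵇ z) ≡ false × V ≡ var n)
∈-bangSub-var⁻ {z} {Q} {n} v with n ≡ᵇ z
∈-bangSub-var⁻ (here e) | true = inj₁ (refl , inj₁ e)
∈-bangSub-var⁻ (there (here e)) | true = inj₁ (refl , inj₂ e)
∈-bangSub-var⁻ (here e) | false = inj₂ (refl , e)

LinSub-var⁻ : ∀ {y N n U} → LinSub y N (var n) U → (n ≡ᵇ y) ≡ true × U ≡ N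
LinSub-var⁻ (ls-var e) = e , refl

mutual
  linSub-after-bangSub : ∀ {y N z Q} → Fresh z N → Fresh z Q → ∀ A {V U} → ParSub (bangSub z Q) A V → LinSub y N V U →
    Σ Term λ W → LinSubAfterBang y N z Q A W × U ≈ W
  linSub-after-bangSub {y} {N} {z} {Q} nN nQ (var n) (ps-var v) u with ∈-bangSub-var⁻ {z} {Q} {n} v
  ... | inj₁ (en , inj₁ refl) = _ , after-arg u (ls-var en) (Fresh⇒ParSub-bangSub (Fresh-lsub nQ nN (LinSub⇒∈ u))) , ≈-refl
  ... | inj₁ (en , inj₂ refl) with LinSub-var⁻ u
  ... | ey , refl = _ , after-body (ls-var ey) (Fresh⇒ParSub-bangSub nN) , ≈-refl
  linSub-after-bangSub {y} {N} {z} {Q} nN nQ (var n) (ps-var v) u | inj₂ (en , refl) with LinSub-var⁻ u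
  ... | ey , refl = _ , after-body (ls-var ey) (Fresh⇒ParSub-bangSub nN) , ≈-refl
  linSub-after-bangSub {y} {N} {z} {Q} nN nQ (lam A) (ps-lam v) (ls-lam u) with linSub-after-bangSub (Fresh-shift nN) (Fresh-shift nQ) A (ParSub-cong (exts-bangSub z Q) v) u
  ... | W , after-body xx ww , r = lam W , after-body (ls-lam xx) (ps-lam (ParSub-cong (λ n → sym (exts-bangSub z Q n)) ww)) , lam r
  ... | W , after-arg ss xx ww , r with LinSub-shift⁻ ss
  ... | S' , ss' , refl = lam W , after-arg ss' (ls-lam xx) (ps-lam (ParSub-cong (λ n → sym (exts-bangSub z Q n)) ww)) , lam r
  linSub-after-bangSub nN nQ (app A P) (ps-app v c) (ls-fun u) with linSub-after-bangSub nN nQ A v u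
  ... | W , after-body xx ww , r = _ , after-body (ls-fun xx) (ps-app ww c) , app r ≈ᵇ-refl
  ... | W , after-arg ss xx ww , r = _ , after-arg ss (ls-fun xx) (ps-app ww c) , app r ≈ᵇ-refl
  linSub-after-bangSub nN nQ (app A P) (ps-app v c) (ls-arg u) with linSubB-after-bangSub nN nQ P c u
  ... | d , afterB-body ee dd , r = _ , after-body (ls-arg ee) (ps-app v dd) , app ≈-refl r
  ... | d , afterB-arg ss ee dd , r = _ , after-arg ss (ls-arg ee) (ps-app v dd) , app ≈-refl r

  linSubB-after-bangSub : ∀ {y N z Q} → Fresh z N → Fresh z Q → ∀ b {c c'} → ParSubB (bangSub z Q) b c → LinSubB y N c c' →
    Σ Bag λ d → LinSubAfterBangB y N z Q b d × c' ≈ᵇ d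
  linSubB-after-bangSub nN nQ [] psb-[] ()
  linSubB-after-bangSub nN nQ (lin M ∷ b) (psb-lin xx cc) (lsb-lin u) with linSub-after-bangSub nN nQ M xx u
  ... | W , after-body yy ww , r = _ , afterB-body (lsb-lin yy) (psb-lin ww cc) , prep (lin r) ≈ᵇ-refl
  ... | W , after-arg ss yy ww , r = _ , afterB-arg ss (lsb-lin yy) (psb-lin ww cc) , prep (lin r) ≈ᵇ-refl
  linSubB-after-bangSub nN nQ (lin M ∷ b) (psb-lin xx cc) (lsb-tl u) with linSubB-after-bangSub nN nQ b cc u
  ... | d , afterB-body ee dd , r = _ , afterB-body (lsb-tl ee) (psb-lin xx dd) , prep ≈ʳ-refl r
  ... | d , afterB-arg ss ee dd , r = _ , afterB-arg ss (lsb-tl ee) (psb-lin xx dd) , prep ≈ʳ-refl r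
  linSubB-after-bangSub {y} {N} {z} {Q} nN nQ (bang M ∷ b) (psb-bang {c = c0} cc) u with LinSubB-bangs⁻ (subst (bangSub z Q) M) c0 u
  ... | inj₁ (Mi , mi , X , xx , r0) with linSub-after-bangSub nN nQ M (∈⇒ParSub M mi) xx
  ... | W , after-body yy ww , r = _ , afterB-body (lsb-bang yy) (psb-lin ww (psb-bang cc)) , trans r0 (prep (lin r) ≈ᵇ-refl)
  ... | W , after-arg ss yy ww , r = _ , afterB-arg ss (lsb-bang yy) (psb-lin ww (psb-bang cc)) , trans r0 (prep (lin r) ≈ᵇ-refl)
  linSubB-after-bangSub {y} {N} {z} {Q} nN nQ (bang M ∷ b) (psb-bang {c = c0} cc) u | inj₂ (c1 , u1 , refl) with linSubB-after-bangSub nN nQ b cc u1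
  ... | d , afterB-body ee dd , r = _ , afterB-body (lsb-tl ee) (psb-bang dd) , ≈ᵇ-++ (≈ᵇ-refl {map bang (subst (bangSub z Q) M)}) r
  ... | d , afterB-arg ss ee dd , r = _ , afterB-arg ss (lsb-tl ee) (psb-bang dd) , ≈ᵇ-++ (≈ᵇ-refl {map bang (subst (bangSub z Q) M)}) r

≡ᵇ-true⇒≡ : ∀ {m n} → (m ≡ᵇ n) ≡ true → m ≡ n
≡ᵇ-true⇒≡ {m} {n} e = ≡ᵇ⇒≡ m n (≡subst T (sym e) tt)

≡ᵇ-refl : ∀ n → (n ≡ᵇ n) ≡ true
≡ᵇ-refl zero = refl
≡ᵇ-refl (suc n) = ≡ᵇ-refl n

var-∈-bangSub : ∀ {z Q n} → (n ≡ᵇ z) ≡ true → var n ∈ bangSub z Q n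
var-∈-bangSub e rewrite e = there (here refl)

mutual
  bangSub-after-linSub : ∀ {z N Q} → Fresh z N → Fresh z Q → ∀ A {X W} → LinSub z N A X → ParSub (bangSub z Q) X W →
    Σ Term λ U → (Σ Term λ V → ParSub (bangSub z Q) A V × LinSub z N V U) × W ≈ U
  bangSub-after-linSub nN nQ (var n) (ls-var e) ww with Fresh-ParSub-bangSub nN ww
  ... | refl = _ , (var n , ps-var (var-∈-bangSub e) , ls-var e) , ≈-refl
  bangSub-after-linSub {z} {N} {Q} nN nQ (lam A) (ls-lam xx) (ps-lam ww)
    with bangSub-after-linSub (Fresh-shift nN) (Fresh-shift nQ) A xx (ParSub-cong (exts-bangSub z Q) ww)
  ... | U , (V , vv , uu) , r = lam U , (lam V , ps-lam (ParSub-cong (λ n → sym (exts-bangSub z Q n)) vv) , ls-lam uu) , lam r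
  bangSub-after-linSub nN nQ (app A P) (ls-fun xx) (ps-app ww c) with bangSub-after-linSub nN nQ A xx ww
  ... | U , (V , vv , uu) , r = _ , (_ , ps-app vv c , ls-fun uu) , app r ≈ᵇ-refl
  bangSub-after-linSub nN nQ (app A P) (ls-arg ee) (ps-app ww d) with bangSubB-after-linSub nN nQ P ee d
  ... | U , (V , vv , uu) , r = _ , (_ , ps-app ww vv , ls-arg uu) , app ≈-refl r

  bangSubB-after-linSub : ∀ {z N Q} → Fresh z N → Fresh z Q → ∀ b {e d} → LinSubB z N b e → ParSubB (bangSub z Q) e d →
    Σ Bag λ U → (Σ Bag λ V → ParSubB (bangSub z Q) b V × LinSubB z N V U) × d ≈ᵇ U
  bangSubB-after-linSub nN nQ (lin M ∷ b) (lsb-lin xx) (psb-lin ww cc) with bangSub-after-linSub nN nQ M xx ww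
  ... | U , (V , vv , uu) , r = _ , (_ , psb-lin vv cc , lsb-lin uu) , prep (lin r) ≈ᵇ-refl
  bangSubB-after-linSub {z} {N} {Q} nN nQ (bang M ∷ b) (lsb-bang xx) (psb-lin ww (psb-bang {c = c0} cc)) with bangSub-after-linSub nN nQ M xx ww
  ... | U , (V , vv , uu) , r with LinSubB-bangs⁺ (subst (bangSub z Q) M) c0 (ParSub⇒∈ vv) uu
  ... | c' , pc , r' = c' , (_ , psb-bang cc , pc) , trans (prep (lin r) ≈ᵇ-refl) (≈ᵇ-sym r')
  bangSubB-after-linSub nN nQ (lin M ∷ b) (lsb-tl ee) (psb-lin ww cc) with bangSubB-after-linSub nN nQ b ee cc
  ... | U , (V , vv , uu) , r = _ , (_ , psb-lin ww vv , lsb-tl uu) , prep ≈ʳ-refl r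
  bangSubB-after-linSub {z} {N} {Q} nN nQ (bang M ∷ b) (lsb-tl ee) (psb-bang cc) with bangSubB-after-linSub nN nQ b ee cc
  ... | U , (V , vv , uu) , r = _ , (_ , psb-bang vv , LinSubB-++ˡ (map bang (subst (bangSub z Q) M)) uu) , ≈ᵇ-++ (≈ᵇ-refl {map bang (subst (bangSub z Q) M)}) r

-- What linSub-after-lowering needs of zeroSub, in a form that is stable under exts.
record Lowering (σ : SSub) (x' x : ℕ) (N' N : Term) : Set where
  field
    lowers : σ x' ≡ [ var x ]
    fresh-elsewhere : ∀ n → (n ≡ᵇ x') ≡ false → ∀ {T} → T ∈ σ n → Fresh x T
    lowers-arg : subst σ N' ≡ [ N ]
open Lowering

Lowering-exts : ∀ {σ x' x N' N} → Lowering σ x' x N' N → Lowering (exts σ) (suc x') (suc x) (shift N') (shift N)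
Lowering-exts {σ} {x'} {x} {N'} {N} L = record
  { lowers = cong (map shift) (lowers L)
  ; fresh-elsewhere = fresh-elsewhere′
  ; lowers-arg = ≡trans (shift-subst σ N') (cong (map shift) (lowers-arg L)) }
  where
  fresh-elsewhere′ : ∀ n → (n ≡ᵇ suc x') ≡ false → ∀ {T} → T ∈ exts σ n → Fresh (suc x) T
  fresh-elsewhere′ zero e (here refl) = fresh-var refl
  fresh-elsewhere′ (suc n) e t with ∈-map⁻ shift t
  ... | T0 , t0 , refl = Fresh-shift (fresh-elsewhere L n e t0)

mutual
  linSub-after-lowering : ∀ {σ x' x N' N} → Lowering σ x' x N' N → ∀ C {V U} → ParSub σ C V → LinSub x N V U →
    Σ Term λ W → (Σ Term λ C' → LinSub x' N' C C' × ParSub σ C' W) × U ≈ W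
  linSub-after-lowering {σ} {x'} {x} {N'} {N} L (var n) (ps-var v) u with n ≡ᵇ x' in e
  ... | true with ≡ᵇ-true⇒≡ {n} {x'} e
  ... | refl with ≡subst (_ ∈_) (lowers L) v
  ... | here refl with LinSub-var⁻ u
  ... | _ , refl = N , (N' , ls-var e , ∈⇒ParSub N' (≡subst (N ∈_) (sym (lowers-arg L)) (here refl))) , ≈-refl
  linSub-after-lowering {σ} {x'} {x} {N'} {N} L (var n) (ps-var v) u | false = ⊥-elim (Fresh⇒¬LinSub (fresh-elsewhere L n e v) u)
  linSub-after-lowering L (lam C) (ps-lam v) (ls-lam u) with linSub-after-lowering (Lowering-exts L) C v u
  ... | W , (C' , cc , ww) , r = lam W , (lam C' , ls-lam cc , ps-lam ww) , lam r
  linSub-after-lowering L (app C P) (ps-app v c) (ls-fun u) with linSub-after-lowering L C v u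
  ... | W , (C' , cc , ww) , r = _ , (_ , ls-fun cc , ps-app ww c) , app r ≈ᵇ-refl
  linSub-after-lowering L (app C P) (ps-app v c) (ls-arg u) with linSubB-after-lowering L P c u
  ... | d , (e , ee , dd) , r = _ , (_ , ls-arg ee , ps-app v dd) , app ≈-refl r

  linSubB-after-lowering : ∀ {σ x' x N' N} → Lowering σ x' x N' N → ∀ b {c c'} → ParSubB σ b c → LinSubB x N c c' →
    Σ Bag λ d → (Σ Bag λ e → LinSubB x' N' b e × ParSubB σ e d) × c' ≈ᵇ d
  linSubB-after-lowering L [] psb-[] ()
  linSubB-after-lowering L (lin M ∷ b) (psb-lin xx cc) (lsb-lin u) with linSub-after-lowering L M xx u
  ... | W , (C' , c1 , ww) , r = _ , (_ , lsb-lin c1 , psb-lin ww cc) , prep (lin r) ≈ᵇ-refl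
  linSubB-after-lowering L (lin M ∷ b) (psb-lin xx cc) (lsb-tl u) with linSubB-after-lowering L b cc u
  ... | d , (e , ee , dd) , r = _ , (_ , lsb-tl ee , psb-lin xx dd) , prep ≈ʳ-refl r
  linSubB-after-lowering {σ} L (bang M ∷ b) (psb-bang {c = c0} cc) u with LinSubB-bangs⁻ (subst σ M) c0 u
  ... | inj₁ (Mi , mi , X , xx , r0) with linSub-after-lowering L M (∈⇒ParSub M mi) xx
  ... | W , (C' , c1 , ww) , r = _ , (_ , lsb-bang c1 , psb-lin ww (psb-bang cc)) , trans r0 (prep (lin r) ≈ᵇ-refl)
  linSubB-after-lowering {σ} L (bang M ∷ b) (psb-bang {c = c0} cc) u | inj₂ (c1 , u1 , refl) with linSubB-after-lowering L b cc u1
  ... | d , (e , ee , dd) , r = _ , (_ , lsb-tl ee , psb-bang dd) , ≈ᵇ-++ (≈ᵇ-refl {map bang (subst σ M)}) r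

mutual
  parSub-after-linSub : ∀ {σ x N} → σ x ≡ [ var x ] → ∀ A {X W} → LinSub x N A X → ParSub σ X W →
    Σ Term λ U → (Σ Term λ N* → ParSub σ N N* × Σ Term λ A* → ParSub σ A A* × LinSub x N* A* U) × W ≈ U
  parSub-after-linSub {σ} {x} {N} h (var n) (ls-var e) ww with ≡ᵇ-true⇒≡ {n} {x} e
  ... | refl = _ , (_ , ww , var n , ps-var (≡subst (var n ∈_) (sym h) (here refl)) , ls-var (≡ᵇ-refl n)) , ≈-refl
  parSub-after-linSub {σ} {x} {N} h (lam A) (ls-lam xx) (ps-lam ww) with parSub-after-linSub {exts σ} {suc x} {shift N} (cong (map shift) h) A xx ww
  ... | U , (N** , nn , A* , aa , uu) , r with ∈-map⁻ shift (≡subst (N** ∈_) (shift-subst σ N) (ParSub⇒∈ nn))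
  ... | N* , n0 , refl = lam U , (N* , ∈⇒ParSub N n0 , lam A* , ps-lam aa , ls-lam uu) , lam r
  parSub-after-linSub h (app A P) (ls-fun xx) (ps-app ww c) with parSub-after-linSub h A xx ww
  ... | U , (N* , nn , A* , aa , uu) , r = _ , (N* , nn , _ , ps-app aa c , ls-fun uu) , app r ≈ᵇ-refl
  parSub-after-linSub h (app A P) (ls-arg ee) (ps-app ww d) with parSubB-after-linSub h P ee d
  ... | U , (N* , nn , P* , pp , uu) , r = _ , (N* , nn , _ , ps-app ww pp , ls-arg uu) , app ≈-refl r

  parSubB-after-linSub : ∀ {σ x N} → σ x ≡ [ var x ] → ∀ b {e d} → LinSubB x N b e → ParSubB σ e d →
    Σ Bag λ U → (Σ Term λ N* → ParSub σ N N* × Σ Bag λ P* → ParSubB σ b P* × LinSubB x N* P* U) × d ≈ᵇ U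
  parSubB-after-linSub h (lin M ∷ b) (lsb-lin xx) (psb-lin ww cc) with parSub-after-linSub h M xx ww
  ... | U , (N* , nn , M* , mm , uu) , r = _ , (N* , nn , _ , psb-lin mm cc , lsb-lin uu) , prep (lin r) ≈ᵇ-refl
  parSubB-after-linSub {σ} h (bang M ∷ b) (lsb-bang xx) (psb-lin ww (psb-bang {c = c0} cc)) with parSub-after-linSub h M xx ww
  ... | U , (N* , nn , M* , mm , uu) , r with LinSubB-bangs⁺ (subst σ M) c0 (ParSub⇒∈ mm) uu
  ... | c' , pc , r' = c' , (N* , nn , _ , psb-bang cc , pc) , trans (prep (lin r) ≈ᵇ-refl) (≈ᵇ-sym r')
  parSubB-after-linSub h (lin M ∷ b) (lsb-tl ee) (psb-lin ww cc) with parSubB-after-linSub h b ee cc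
  ... | U , (N* , nn , P* , pp , uu) , r = _ , (N* , nn , _ , psb-lin ww pp , lsb-tl uu) , prep ≈ʳ-refl r
  parSubB-after-linSub {σ} h (bang M ∷ b) (lsb-tl ee) (psb-bang cc) with parSubB-after-linSub h b ee cc
  ... | U , (N* , nn , P* , pp , uu) , r = _ , (N* , nn , _ , psb-bang pp , LinSubB-++ˡ (map bang (subst σ M)) uu) , ≈ᵇ-++ (≈ᵇ-refl {map bang (subst σ M)}) r

-- Bag substitution and the giant step

data BagSub : Bag → Term → Term → Set where
  bs-nil  : ∀ {A} → BagSub [] A A
  bs-lin  : ∀ {N b A A1 U} → LinSub 0 (shift N) A A1 → BagSub b A1 U → BagSub (lin N ∷ b) A U
  bs-bang : ∀ {N b A A1 U} → ParSub (bangSub 0 (shift N)) A A1 → BagSub b A1 U → BagSub (bang N ∷ b) A U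

BagSub⇒∈ : ∀ {P A U} → BagSub P A U → U ∈ bagSub P A
BagSub⇒∈ bs-nil = here refl
BagSub⇒∈ (bs-lin {b = b} a r) = ∈-concatMap⁺′ (bagSub b) (LinSub⇒∈ a) (BagSub⇒∈ r)
BagSub⇒∈ (bs-bang {b = b} a r) = ∈-concatMap⁺′ (bagSub b) (ParSub⇒∈ a) (BagSub⇒∈ r)

∈⇒BagSub : ∀ P A {U} → U ∈ bagSub P A → BagSub P A U
∈⇒BagSub [] A (here refl) = bs-nil
∈⇒BagSub [] A (there ())
∈⇒BagSub (lin N ∷ b) A u with ∈-concatMap⁻′ (bagSub b) (lsub zero (shift N) A) u
... | A1 , a1 , r = bs-lin (∈⇒LinSub A a1) (∈⇒BagSub b A1 r)
∈⇒BagSub (bang N ∷ b) A u with ∈-concatMap⁻′ (bagSub b) (bsub zero (shift N) A) u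
... | A1 , a1 , r = bs-bang (∈⇒ParSub A a1) (∈⇒BagSub b A1 r)

BagSub-++ : ∀ {c d A V U} → BagSub c A V → BagSub d V U → BagSub (c ++ d) A U
BagSub-++ bs-nil q = q
BagSub-++ (bs-lin a p) q = bs-lin a (BagSub-++ p q)
BagSub-++ (bs-bang a p) q = bs-bang a (BagSub-++ p q)

data Giant (B : Term) (Q : Bag) (U : Term) : Set where
  gi : ∀ {V} → BagSub Q B V → ParSub zeroSub V U → Giant B Q U

Giant⇒∈ : ∀ {B Q U} → Giant B Q U → U ∈ giant B Q
Giant⇒∈ {B} {Q} (gi v u) = ∈-concatMap⁺′ (subst zeroSub) (BagSub⇒∈ v) (ParSub⇒∈ u)

∈⇒Giant : ∀ B Q {U} → U ∈ giant B Q → Giant B Q U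
∈⇒Giant B Q u with ∈-concatMap⁻′ (subst zeroSub) (bagSub Q B) u
... | V , v , w = gi (∈⇒BagSub Q B v) (∈⇒ParSub V w)

LinSub-≈ : ∀ {x N N' A A' A1} → N ≈ N' → A ≈ A' → LinSub x N A A1 → Σ Term λ A1' → LinSub x N' A' A1' × A1 ≈ A1'
LinSub-≈ {A' = A'} eN eA a with lsub-≈ eN eA (LinSub⇒∈ a)
... | A1' , m , r = A1' , ∈⇒LinSub A' m , r

ParSub-≈ : ∀ {σ A A' A1} → A ≈ A' → ParSub σ A A1 → Σ Term λ A1' → ParSub σ A' A1' × A1 ≈ A1'
ParSub-≈ {σ} {A' = A'} eA a with subst-≈-⊑ σ eA (ParSub⇒∈ a)
... | A1' , m , r = A1' , ∈⇒ParSub A' m , r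

ParSub-≈Σ : ∀ {σ τ} → (∀ n → σ n ≈Σ τ n) → ∀ {A A1} → ParSub σ A A1 → Σ Term λ A1' → ParSub τ A A1' × A1 ≈ A1'
ParSub-≈Σ e {A} a with subst-≈Σ-⊑ e A (ParSub⇒∈ a)
... | A1' , m , r = A1' , ∈⇒ParSub A m , r

BagSub-≈-body : ∀ {Q A A' U} → A ≈ A' → BagSub Q A U → Σ Term λ U' → BagSub Q A' U' × U ≈ U'
BagSub-≈-body e bs-nil = _ , bs-nil , e
BagSub-≈-body e (bs-lin a r) with LinSub-≈ ≈-refl e a
... | A1' , a' , e1 with BagSub-≈-body e1 r
... | U' , r' , e2 = U' , bs-lin a' r' , e2
BagSub-≈-body e (bs-bang a r) with ParSub-≈ e a
... | A1' , a' , e1 with BagSub-≈-body e1 r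
... | U' , r' , e2 = U' , bs-bang a' r' , e2

subst-shift-id : ∀ {σ : SSub} → (∀ n → σ (suc n) ≡ [ var (suc n) ]) → ∀ T → subst σ (shift T) ≡ [ shift T ]
subst-shift-id {σ} h T = ≡trans (subst-rename σ suc T) (subst-renaming {ρ = suc} h T)

bangSub-≈ : ∀ {N N'} → N ≈ N' → ∀ n → bangSub 0 (shift N) n ≈Σ bangSub 0 (shift N') n
bangSub-≈ e zero = ↭.prep (rename-≈ suc e) ≈Σ.↭-refl
bangSub-≈ e (suc n) = ≈Σ.↭-refl

bangSub-⨾-comm : ∀ N Q n → (bangSub 0 (shift N) ⨾ bangSub 0 (shift Q)) n ≈Σ (bangSub 0 (shift Q) ⨾ bangSub 0 (shift N)) n
bangSub-⨾-comm N Q zero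
  rewrite subst-shift-id {bangSub 0 (shift Q)} (λ n → refl) N | subst-shift-id {bangSub 0 (shift N)} (λ n → refl) Q
  = ↭.swap ≈-refl ≈-refl ≈Σ.↭-refl
bangSub-⨾-comm N Q (suc n) = ≈Σ.↭-refl

-- The bag's resources are shifted past the binder, so 0 is fresh in them and the cases where one
-- of them is substituted into the other (comm-arg, after-arg) are impossible.
BagSub-swap : ∀ r s {b A U} → BagSub (r ∷ s ∷ b) A U → Σ Term λ U' → BagSub (s ∷ r ∷ b) A U' × U ≈ U'
BagSub-swap (lin N) (lin Q) (bs-lin a1 (bs-lin a2 rest)) with linSub-comm (Fresh-shift₀ Q) a1 a2
... | W , comm-body xx ww , e with BagSub-≈-body e rest
... | U' , rest' , e' = U' , bs-lin xx (bs-lin ww rest') , e'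
BagSub-swap (lin N) (lin Q) (bs-lin a1 (bs-lin a2 rest)) | W , comm-arg qq ww , e = ⊥-elim (Fresh⇒¬LinSub (Fresh-shift₀ N) qq)
BagSub-swap (lin N) (bang Q) {A = A} (bs-lin a1 (bs-bang a2 rest)) with bangSub-after-linSub (Fresh-shift₀ N) (Fresh-shift₀ Q) A a1 a2
... | U , (V , vv , uu) , e with BagSub-≈-body e rest
... | U' , rest' , e' = U' , bs-bang vv (bs-lin uu rest') , e'
BagSub-swap (bang N) (lin Q) {A = A} (bs-bang a1 (bs-lin a2 rest)) with linSub-after-bangSub (Fresh-shift₀ Q) (Fresh-shift₀ N) A a1 a2
... | W , after-body xx ww , e with BagSub-≈-body e rest
... | U' , rest' , e' = U' , bs-lin xx (bs-bang ww rest') , e'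
BagSub-swap (bang N) (lin Q) {A = A} (bs-bang a1 (bs-lin a2 rest)) | W , after-arg ss xx ww , e = ⊥-elim (Fresh⇒¬LinSub (Fresh-shift₀ N) ss)
BagSub-swap (bang N) (bang Q) {A = A} (bs-bang {A1 = A1} a1 (bs-bang {A1 = A2} a2 rest))
  with ∈≈-resp-≈Σ (↭.trans (subst-⨾ (bangSub 0 (shift N)) (bangSub 0 (shift Q)) A)
                 (↭.trans (subst-≈Σ (bangSub-⨾-comm N Q) A) (≈Σ.↭-sym (subst-⨾ (bangSub 0 (shift Q)) (bangSub 0 (shift N)) A))))
                (∈⇒∈≈ (∈-concatMap⁺′ (subst (bangSub 0 (shift Q))) (ParSub⇒∈ a1) (ParSub⇒∈ a2)))
... | A2' , m , e with ∈-concatMap⁻′ (subst (bangSub 0 (shift N))) (subst (bangSub 0 (shift Q)) A) m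
... | A1' , m1 , m2 with BagSub-≈-body e rest
... | U' , rest' , e' = U' , bs-bang (∈⇒ParSub A m1) (bs-bang (∈⇒ParSub A1' m2) rest') , e'

BagSub-≈ : ∀ {Q Q' A A' U} → A ≈ A' → Q ≈ᵇ Q' → BagSub Q A U → Σ Term λ U' → BagSub Q' A' U' × U ≈ U'
BagSub-≈ e nil bs-nil = _ , bs-nil , e
BagSub-≈ e (prep (lin eN) q) (bs-lin a r) with LinSub-≈ (rename-≈ suc eN) e a
... | A1' , a' , e1 with BagSub-≈ e1 q r
... | U' , r' , e2 = U' , bs-lin a' r' , e2
BagSub-≈ {A' = A'} e (prep (bang eN) q) (bs-bang a r) with ParSub-≈ e a
... | A1' , a' , e1 with ParSub-≈Σ (bangSub-≈ eN) a'
... | A1'' , a'' , e1' with BagSub-≈ (≈-trans e1 e1') q r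
... | U' , r' , e2 = U' , bs-bang a'' r' , e2
BagSub-≈ e (swap {r} {s}) p with BagSub-swap r s p
... | U1 , p1 , e1 with BagSub-≈-body e p1
... | U' , p' , e' = U' , p' , ≈-trans e1 e'
BagSub-≈ e (trans q q') p with BagSub-≈ e q p
... | U1 , p1 , e1 with BagSub-≈ ≈-refl q' p1
... | U' , p' , e' = U' , p' , ≈-trans e1 e'

Giant-≈ : ∀ {B B' Q Q' U} → B ≈ B' → Q ≈ᵇ Q' → Giant B Q U → Σ Term λ U' → Giant B' Q' U' × U ≈ U'
Giant-≈ eB eQ (gi v u) with BagSub-≈ eB eQ v
... | V' , v' , e with ParSub-≈ e u
... | U' , u' , e' = U' , gi v' u' , e'

-- Substitutes L + 0 for the bound variable 0 (L shifted past the binder): the bag L^! in one go.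
bangsSub : List Term → SSub
bangsSub L n = if n ≡ᵇ 0 then map shift L ++ [ var n ] else [ var n ]

bangSub-⨾-bangsSub : ∀ N L n → (bangSub 0 (shift N) ⨾ bangsSub L) n ≈Σ bangsSub (N ∷ L) n
bangSub-⨾-bangsSub N L zero rewrite subst-shift-id {bangsSub L} (λ n → refl) N | ++-identityʳ (map shift L ++ [ var 0 ]) = ≈Σ.↭-refl
bangSub-⨾-bangsSub N L (suc n) = ≈Σ.↭-refl

subst-bangsSub-[] : ∀ A → subst (bangsSub []) A ≡ [ A ]
subst-bangsSub-[] A = ≡trans (subst-renaming {ρ = λ n → n} e A) (cong [_] (rename-id (λ n → refl) A))
  where
  e : ∀ n → bangsSub [] n ≡ [ var n ]
  e zero = refl
  e (suc n) = refl

ParSub-bangsSub⇒BagSub : ∀ L {A A2} → ParSub (bangsSub L) A A2 → Σ Term λ A3 → BagSub (map bang L) A A3 × A2 ≈ A3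
ParSub-bangsSub⇒BagSub [] {A} {A2} p with ≡subst (A2 ∈_) (subst-bangsSub-[] A) (ParSub⇒∈ p)
... | here refl = A , bs-nil , ≈-refl
ParSub-bangsSub⇒BagSub (N ∷ L) {A} {A2} p
  with ∈≈-resp-≈Σ (↭.trans (subst-≈Σ (λ n → ≈Σ.↭-sym (bangSub-⨾-bangsSub N L n)) A) (≈Σ.↭-sym (subst-⨾ (bangSub 0 (shift N)) (bangsSub L) A))) (∈⇒∈≈ (ParSub⇒∈ p))
... | A2' , m , e with ∈-concatMap⁻′ (subst (bangsSub L)) (subst (bangSub 0 (shift N)) A) m
... | A1 , m1 , m2 with ParSub-bangsSub⇒BagSub L (∈⇒ParSub A1 m2)
... | A3 , bs3 , e3 = A3 , bs-bang (∈⇒ParSub A m1) bs3 , ≈-trans e e3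

bangSub-⨾-exts : ∀ σ N n → (bangSub 0 (shift N) ⨾ exts σ) n ≈Σ (exts σ ⨾ bangsSub (subst σ N)) n
bangSub-⨾-exts σ N zero rewrite shift-subst σ N | ++-identityʳ (map shift (subst σ N) ++ [ var 0 ]) = ≈Σ.↭-refl
bangSub-⨾-exts σ N (suc n) = ≈Σ.↭-reflexive (≡trans (++-identityʳ (map shift (σ n)))
  (sym (≡trans (concatMap-map (subst (bangsSub (subst σ N))) shift (σ n))
       (≡trans (concatMap-cong (subst-shift-id {bangsSub (subst σ N)} (λ n → refl)) (σ n)) (concatMap-singleton shift (σ n))))))

BagSub-parSub : ∀ σ {Q B V U} → BagSub Q B V → ParSub (exts σ) V U →
  Σ Bag λ Q* → ParSubB σ Q Q* × Σ Term λ B* → ParSub (exts σ) B B* × Σ Term λ U' → BagSub Q* B* U' × U ≈ U'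
BagSub-parSub σ {B = B} bs-nil u = [] , psb-[] , _ , u , _ , bs-nil , ≈-refl
BagSub-parSub σ (bs-lin {N = N} {A = A} a1 rest) u with BagSub-parSub σ rest u
... | Qb , qq , A1* , aa1 , U' , bsU , e with parSub-after-linSub {exts σ} {0} {shift N} refl A a1 aa1
... | U1 , (N** , nn , A* , aa , uu) , e1 with ∈-map⁻ shift (≡subst (N** ∈_) (shift-subst σ N) (ParSub⇒∈ nn))
... | N* , n0 , refl with BagSub-≈-body e1 bsU
... | U'' , bs'' , e2 = lin N* ∷ Qb , psb-lin (∈⇒ParSub N n0) qq , A* , aa , U'' , bs-lin uu bs'' , ≈-trans e e2
BagSub-parSub σ (bs-bang {N = N} {A = A} a1 rest) u with BagSub-parSub σ rest u
... | Qb , qq , A1* , aa1 , U' , bsU , e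
  with ∈≈-resp-≈Σ (↭.trans (subst-⨾ (bangSub 0 (shift N)) (exts σ) A)
                 (↭.trans (subst-≈Σ (bangSub-⨾-exts σ N) A) (≈Σ.↭-sym (subst-⨾ (exts σ) (bangsSub (subst σ N)) A))))
                (∈⇒∈≈ (∈-concatMap⁺′ (subst (exts σ)) (ParSub⇒∈ a1) (ParSub⇒∈ aa1)))
... | A2 , m , e1 with ∈-concatMap⁻′ (subst (bangsSub (subst σ N))) (subst (exts σ) A) m
... | A* , m1 , m2 with ParSub-bangsSub⇒BagSub (subst σ N) (∈⇒ParSub A* m2)
... | A3 , bs3 , e3 with BagSub-≈-body (≈-trans e1 e3) bsU
... | U'' , bs'' , e2 = map bang (subst σ N) ++ Qb , psb-bang qq , A* , ∈⇒ParSub A m1 , U'' , BagSub-++ bs3 bs'' , ≈-trans e e2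

BagSub-linSub : ∀ {x N Q B V V'} → BagSub Q B V → LinSub (suc x) (shift N) V V' →
  (Σ Term λ B* → LinSub (suc x) (shift N) B B* × Σ Term λ U → BagSub Q B* U × V' ≈ U) ⊎
  (Σ Bag λ Q* → LinSubB x N Q Q* × Σ Term λ U → BagSub Q* B U × V' ≈ U)
BagSub-linSub bs-nil u = inj₁ (_ , u , _ , bs-nil , ≈-refl)
BagSub-linSub {x} {N} (bs-lin {N = R} a1 rest) u with BagSub-linSub rest u
... | inj₂ (Qb , qq , U , bsU , e) = inj₂ (_ , lsb-tl qq , U , bs-lin a1 bsU , e)
... | inj₁ (A1' , la , U , bsU , e) with linSub-comm (Fresh-shift₀ N) a1 la
... | W , comm-body xx ww , e1 with BagSub-≈-body e1 bsU
... | U' , bs' , e2 = inj₁ (_ , xx , U' , bs-lin ww bs' , ≈-trans e e2)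
BagSub-linSub {x} {N} (bs-lin {N = R} a1 rest) u | inj₁ (A1' , la , U , bsU , e) | W , comm-arg qq ww , e1 with LinSub-shift⁻ qq
... | R'' , rr , refl with BagSub-≈-body e1 bsU
... | U' , bs' , e2 = inj₂ (_ , lsb-lin rr , U' , bs-lin ww bs' , ≈-trans e e2)
BagSub-linSub {x} {N} (bs-bang {N = R} {A = A} a1 rest) u with BagSub-linSub rest u
... | inj₂ (Qb , qq , U , bsU , e) = inj₂ (_ , lsb-tl qq , U , bs-bang a1 bsU , e)
... | inj₁ (A1' , la , U , bsU , e) with linSub-after-bangSub (Fresh-shift₀ N) (Fresh-shift₀ R) A a1 la
... | W , after-body xx ww , e1 with BagSub-≈-body e1 bsU
... | U' , bs' , e2 = inj₁ (_ , xx , U' , bs-bang ww bs' , ≈-trans e e2)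
BagSub-linSub {x} {N} (bs-bang {N = R} {A = A} a1 rest) u | inj₁ (A1' , la , U , bsU , e) | W , after-arg ss xx ww , e1 with LinSub-shift⁻ ss
... | R'' , rr , refl with BagSub-≈-body e1 bsU
... | U' , bs' , e2 = inj₂ (_ , lsb-bang rr , U' , bs-lin xx (bs-bang ww bs') , ≈-trans e e2)

zeroSub-⨾ : ∀ σ n → (zeroSub ⨾ σ) n ≈Σ (exts σ ⨾ zeroSub) n
zeroSub-⨾ σ zero = ≈Σ.↭-refl
zeroSub-⨾ σ (suc n) = ≈Σ.↭-reflexive (≡trans (++-identityʳ (σ n))
  (sym (≡trans (concatMap-map (subst zeroSub) shift (σ n)) (≡trans (concatMap-cong subst-zeroSub-shift (σ n)) (concatMap-pure (σ n))))))

Giant-parSub : ∀ σ {B Q W U} → Giant B Q W → ParSub σ W U →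
  Σ Term λ B* → ParSub (exts σ) B B* × Σ Bag λ Q* → ParSubB σ Q Q* × Σ Term λ U' → Giant B* Q* U' × U ≈ U'
Giant-parSub σ (gi {V} v w) u
  with ∈≈-resp-≈Σ (↭.trans (subst-⨾ zeroSub σ V) (↭.trans (subst-≈Σ (zeroSub-⨾ σ) V) (≈Σ.↭-sym (subst-⨾ (exts σ) zeroSub V))))
                (∈⇒∈≈ (∈-concatMap⁺′ (subst σ) (ParSub⇒∈ w) (ParSub⇒∈ u)))
... | U1 , m , e with ∈-concatMap⁻′ (subst zeroSub) (subst (exts σ) V) m
... | V1 , m1 , m2 with BagSub-parSub σ v (∈⇒ParSub V m1)
... | Q* , qq , B* , bb , U2 , bs2 , e2 with ParSub-≈ e2 (∈⇒ParSub V1 m2)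
... | U3 , u3 , e3 = B* , bb , Q* , qq , U3 , gi bs2 u3 , ≈-trans e e3

zeroSub-Lowering : ∀ x N → Lowering zeroSub (suc x) x (shift N) N
zeroSub-Lowering x N = record { lowers = refl ; fresh-elsewhere = fresh-elsewhere′ ; lowers-arg = subst-zeroSub-shift N }
  where
  fresh-elsewhere′ : ∀ n → (n ≡ᵇ suc x) ≡ false → ∀ {T} → T ∈ zeroSub n → Fresh x T
  fresh-elsewhere′ zero e ()
  fresh-elsewhere′ (suc n) e (here refl) = fresh-var e

Giant-linSub : ∀ {x N B Q W U} → Giant B Q W → LinSub x N W U →
  (Σ Term λ B* → LinSub (suc x) (shift N) B B* × Σ Term λ U' → Giant B* Q U' × U ≈ U') ⊎
  (Σ Bag λ Q* → LinSubB x N Q Q* × Σ Term λ U' → Giant B Q* U' × U ≈ U')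
Giant-linSub {x} {N} (gi {V} v w) u with linSub-after-lowering (zeroSub-Lowering x N) V w u
... | U1 , (C' , cc , ww) , e with BagSub-linSub v cc
... | inj₁ (B* , bb , U2 , bs2 , e2) with ParSub-≈ e2 ww
... | U3 , u3 , e3 = inj₁ (B* , bb , U3 , gi bs2 u3 , ≈-trans e e3)
Giant-linSub {x} {N} (gi {V} v w) u | U1 , (C' , cc , ww) , e | inj₂ (Q* , qq , U2 , bs2 , e2) with ParSub-≈ e2 ww
... | U3 , u3 , e3 = inj₂ (Q* , qq , U3 , gi bs2 u3 , ≈-trans e e3)

prependPos : ∀ d {b} → BPos b → BPos (d ++ b)
prependPos [] q = q
prependPos (r ∷ d) q = inTail (prependPos d q)

prependPos-Outer : ∀ d {b} (q : BPos b) → OuterB q → OuterB (prependPos d q)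
prependPos-Outer [] q o = o
prependPos-Outer (r ∷ d) q o = prependPos-Outer d q o

fireB-tail : ∀ r b (q : BPos b) → fireB (r ∷ b) (inTail q) ≡ map (r ∷_) (fireB b q)
fireB-tail (lin M) b q = refl
fireB-tail (bang M) b q = refl

fireB-prependPos : ∀ d {b} (q : BPos b) → fireB (d ++ b) (prependPos d q) ≡ map (d ++_) (fireB b q)
fireB-prependPos [] q = sym (map-id _)
fireB-prependPos (r ∷ d) {b} q = ≡trans (fireB-tail r (d ++ b) (prependPos d q))
  (≡trans (cong (map (r ∷_)) (fireB-prependPos d q)) (sym (map-∘ (fireB b q))))

fire-fun : ∀ A P (p : TPos A) → fire (app A P) (inFun p) ≡ map (λ M' → app M' P) (fire A p)
fire-fun (var n) P ()
fire-fun (lam B) P p = refl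
fire-fun (app B Q) P p = refl

fire-arg : ∀ A P (q : BPos P) → fire (app A P) (inArg q) ≡ map (app A) (fireB P q)
fire-arg (var n) P q = refl
fire-arg (lam B) P q = refl
fire-arg (app B Q) P q = refl

∈-fire-inFun⁻ : ∀ {A P p A'} → A' ∈ fire (app A P) (inFun p) → Σ Term λ A0' → A0' ∈ fire A p × A' ≡ app A0' P
∈-fire-inFun⁻ {A} {P} {p} a = ∈-map⁻ (λ M' → app M' P) (≡subst (_ ∈_) (fire-fun A P p) a)

∈-fire-inArg⁻ : ∀ {A P q A'} → A' ∈ fire (app A P) (inArg q) → Σ Bag λ P' → P' ∈ fireB P q × A' ≡ app A P'
∈-fire-inArg⁻ {A} {P} {q} a = ∈-map⁻ (app A) (≡subst (_ ∈_) (fire-arg A P q) a)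

∈-fire-inFun⁺ : ∀ {A P p A0'} → A0' ∈ fire A p → app A0' P ∈ fire (app A P) (inFun p)
∈-fire-inFun⁺ {A} {P} {p} a = ≡subst (_ ∈_) (sym (fire-fun A P p)) (∈-map⁺ (λ M' → app M' P) a)

∈-fire-inArg⁺ : ∀ {A P q P'} → P' ∈ fireB P q → app A P' ∈ fire (app A P) (inArg q)
∈-fire-inArg⁺ {A} {P} {q} a = ≡subst (_ ∈_) (sym (fire-arg A P q)) (∈-map⁺ (app A) a)

∈≈-fire-inFun : ∀ {A P p U} → U ∈≈ map (λ M' → app M' P) (fire A p) → U ∈≈ fire (app A P) (inFun p)
∈≈-fire-inFun {A} {P} {p} m = ≡subst (_ ∈≈_) (sym (fire-fun A P p)) m

∈≈-fire-inArg : ∀ {A P q U} → U ∈≈ map (app A) (fireB P q) → U ∈≈ fire (app A P) (inArg q)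
∈≈-fire-inArg {A} {P} {q} m = ≡subst (_ ∈≈_) (sym (fire-arg A P q)) m

app-∈≈ˡ : ∀ {U L c} → U ∈≈ L → app U c ∈≈ map (λ M' → app M' c) L
app-∈≈ˡ {c = c} = ∈⟨⟩-map {R = _≈_} {R' = _≈_} (λ M' → app M' c) (λ r → app r ≈ᵇ-refl)

app-∈≈ʳ : ∀ {M c L} → c ∈≈ᵇ L → app M c ∈≈ map (app M) L
app-∈≈ʳ {M} = ∈⟨⟩-map {R = _≈ᵇ_} {R' = _≈_} (app M) (λ r → app ≈-refl r)

lin-∈≈ᵇ : ∀ {X c L} → X ∈≈ L → (lin X ∷ c) ∈≈ᵇ map (λ M' → lin M' ∷ c) L
lin-∈≈ᵇ {c = c} = ∈⟨⟩-map {R = _≈_} {R' = _≈ᵇ_} (λ M' → lin M' ∷ c) (λ r → prep (lin r) ≈ᵇ-refl)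

∷-∈≈ᵇ : ∀ {r c L} → c ∈≈ᵇ L → (r ∷ c) ∈≈ᵇ map (r ∷_) L
∷-∈≈ᵇ {r} = ∈⟨⟩-map {R = _≈ᵇ_} {R' = _≈ᵇ_} (r ∷_) (λ e → prep ≈ʳ-refl e)

++-∈≈ᵇ : ∀ d {c L} → c ∈≈ᵇ L → (d ++ c) ∈≈ᵇ map (d ++_) L
++-∈≈ᵇ d = ∈⟨⟩-map {R = _≈ᵇ_} {R' = _≈ᵇ_} (d ++_) (λ e → ≈ᵇ-++ (≈ᵇ-refl {d}) e)

-- Substitutions reflect outer steps

-- If A → A' fires p and U is a summand of the substituted A', then U is reached by one outer
-- step from a summand of the substituted A. This is what lets the giant step be fired first.
mutual
  fire-parSub : ∀ σ A (p : TPos A) → Outer p → ∀ {A' U} → A' ∈ fire A p → ParSub σ A' U →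
    Σ Term λ T → ParSub σ A T × Σ (TPos T) λ r → Outer r × U ∈≈ fire T r
  fire-parSub σ (app (lam B) Q) here o a u with Giant-parSub σ (∈⇒Giant B Q a) u
  ... | B* , bb , Q* , qq , U' , g , e = app (lam B*) Q* , ps-app (ps-lam bb) qq , here , tt , (U' , Giant⇒∈ g , e)
  fire-parSub σ (lam A) (inLam p) o a u with ∈-map⁻ lam a
  fire-parSub σ (lam A) (inLam p) o a (ps-lam u) | A0' , a0 , refl with fire-parSub (exts σ) A p o a0 u
  ... | T0 , tt0 , r0 , o0 , m = lam T0 , ps-lam tt0 , inLam r0 , o0 , lam-∈≈ m
  fire-parSub σ (app A P) (inFun p) o a u with ∈-fire-inFun⁻ {A} {P} {p} a
  fire-parSub σ (app A P) (inFun p) o a (ps-app u0 c) | A0' , a0 , refl with fire-parSub σ A p o a0 u0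
  ... | T0 , tt0 , r0 , o0 , m = app T0 _ , ps-app tt0 c , inFun r0 , o0 , ∈≈-fire-inFun {A = T0} {p = r0} (app-∈≈ˡ m)
  fire-parSub σ (app A P) (inArg q) o a u with ∈-fire-inArg⁻ {A} {P} {q} a
  fire-parSub σ (app A P) (inArg q) o a (ps-app u0 c) | P' , a0 , refl with fireB-parSubB σ P q o a0 c
  ... | Tb , tb , rb , ob , m = app _ Tb , ps-app u0 tb , inArg rb , ob , ∈≈-fire-inArg {P = Tb} {q = rb} (app-∈≈ʳ m)

  fireB-parSubB : ∀ σ P (q : BPos P) → OuterB q → ∀ {P' c} → P' ∈ fireB P q → ParSubB σ P' c →
    Σ Bag λ Tb → ParSubB σ P Tb × Σ (BPos Tb) λ rb → OuterB rb × c ∈≈ᵇ fireB Tb rb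
  fireB-parSubB σ (lin M ∷ b) (inLin p) o a u with ∈-map⁻ (λ M' → lin M' ∷ b) a
  fireB-parSubB σ (lin M ∷ b) (inLin p) o a (psb-lin xx cc) | M' , a0 , refl with fire-parSub σ M p o a0 xx
  ... | T0 , tt0 , r0 , o0 , m = lin T0 ∷ _ , psb-lin tt0 cc , inLin r0 , o0 , lin-∈≈ᵇ m
  fireB-parSubB σ (bang M ∷ b) (inBang p) () a u
  fireB-parSubB σ (lin M ∷ b) (inTail q) o a u with ∈-map⁻ (lin M ∷_) a
  fireB-parSubB σ (lin M ∷ b) (inTail q) o a (psb-lin xx cc) | b' , a0 , refl with fireB-parSubB σ b q o a0 cc
  ... | Tb , tb , rb , ob , m = lin _ ∷ Tb , psb-lin xx tb , inTail rb , ob , ∷-∈≈ᵇ m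
  fireB-parSubB σ (bang M ∷ b) (inTail q) o a u with ∈-map⁻ (bang M ∷_) a
  fireB-parSubB σ (bang M ∷ b) (inTail q) o a (psb-bang cc) | b' , a0 , refl with fireB-parSubB σ b q o a0 cc
  ... | Tb , tb , rb , ob , m = map bang (subst σ M) ++ Tb , psb-bang tb , prependPos (map bang (subst σ M)) rb ,
        prependPos-Outer (map bang (subst σ M)) rb ob ,
        ≡subst (_ ∈≈ᵇ_) (sym (fireB-prependPos (map bang (subst σ M)) rb)) (++-∈≈ᵇ (map bang (subst σ M)) m)

mutual
  fire-linSub : ∀ {x N} A (p : TPos A) → Outer p → ∀ {A' U} → A' ∈ fire A p → LinSub x N A' U →
    Σ Term λ T → LinSub x N A T × Σ (TPos T) λ r → Outer r × U ∈≈ fire T r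
  fire-linSub (app (lam B) Q) here o a u with Giant-linSub (∈⇒Giant B Q a) u
  ... | inj₁ (B* , bb , U' , g , e) = app (lam B*) Q , ls-fun (ls-lam bb) , here , tt , (U' , Giant⇒∈ g , e)
  ... | inj₂ (Q* , qq , U' , g , e) = app (lam B) Q* , ls-arg qq , here , tt , (U' , Giant⇒∈ g , e)
  fire-linSub (lam A) (inLam p) o a u with ∈-map⁻ lam a
  fire-linSub (lam A) (inLam p) o a (ls-lam u) | A0' , a0 , refl with fire-linSub A p o a0 u
  ... | T0 , tt0 , r0 , o0 , m = lam T0 , ls-lam tt0 , inLam r0 , o0 , lam-∈≈ m
  fire-linSub (app A P) (inFun p) o a u with ∈-fire-inFun⁻ {A} {P} {p} a
  fire-linSub (app A P) (inFun p) o a (ls-fun u0) | A0' , a0 , refl with fire-linSub A p o a0 u0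
  ... | T0 , tt0 , r0 , o0 , m = app T0 P , ls-fun tt0 , inFun r0 , o0 , ∈≈-fire-inFun {A = T0} {p = r0} (app-∈≈ˡ m)
  fire-linSub (app A P) (inFun p) o a (ls-arg {c = c} cc) | A0' , a0 , refl =
    app A c , ls-arg cc , inFun p , o , ∈⇒∈≈ (∈-fire-inFun⁺ {A} {c} {p} a0)
  fire-linSub (app A P) (inArg q) o a u with ∈-fire-inArg⁻ {A} {P} {q} a
  fire-linSub (app A P) (inArg q) o a (ls-fun {U = U0} u0) | P' , a0 , refl =
    app U0 P , ls-fun u0 , inArg q , o , ∈⇒∈≈ (∈-fire-inArg⁺ {U0} {P} {q} a0)
  fire-linSub (app A P) (inArg q) o a (ls-arg cc) | P' , a0 , refl with fireB-linSubB P q o a0 cc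
  ... | Tb , tb , rb , ob , m = app A Tb , ls-arg tb , inArg rb , ob , ∈≈-fire-inArg {P = Tb} {q = rb} (app-∈≈ʳ m)

  fireB-linSubB : ∀ {x N} P (q : BPos P) → OuterB q → ∀ {P' c} → P' ∈ fireB P q → LinSubB x N P' c →
    Σ Bag λ Tb → LinSubB x N P Tb × Σ (BPos Tb) λ rb → OuterB rb × c ∈≈ᵇ fireB Tb rb
  fireB-linSubB (lin M ∷ b) (inLin p) o a u with ∈-map⁻ (λ M' → lin M' ∷ b) a
  fireB-linSubB (lin M ∷ b) (inLin p) o a (lsb-lin xx) | M' , a0 , refl with fire-linSub M p o a0 xx
  ... | T0 , tt0 , r0 , o0 , m = lin T0 ∷ b , lsb-lin tt0 , inLin r0 , o0 , lin-∈≈ᵇ m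
  fireB-linSubB (lin M ∷ b) (inLin p) o a (lsb-tl {c = c0} cc) | M' , a0 , refl =
    lin M ∷ c0 , lsb-tl cc , inLin p , o , ∈⇒∈≈ᵇ (∈-map⁺ (λ M'' → lin M'' ∷ c0) a0)
  fireB-linSubB (bang M ∷ b) (inBang p) () a u
  fireB-linSubB (lin M ∷ b) (inTail q) o a u with ∈-map⁻ (lin M ∷_) a
  fireB-linSubB (lin M ∷ b) (inTail q) o a (lsb-lin {X = X} xx) | b' , a0 , refl =
    lin X ∷ b , lsb-lin xx , inTail q , o , ∈⇒∈≈ᵇ (∈-map⁺ (lin X ∷_) a0)
  fireB-linSubB (lin M ∷ b) (inTail q) o a (lsb-tl cc) | b' , a0 , refl with fireB-linSubB b q o a0 cc
  ... | Tb , tb , rb , ob , m = lin M ∷ Tb , lsb-tl tb , inTail rb , ob , ∷-∈≈ᵇ m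
  fireB-linSubB (bang M ∷ b) (inTail q) o a u with ∈-map⁻ (bang M ∷_) a
  fireB-linSubB (bang M ∷ b) (inTail q) o a (lsb-bang {X = X} xx) | b' , a0 , refl =
    lin X ∷ bang M ∷ b , lsb-bang xx , inTail (inTail q) , o , ∈⇒∈≈ᵇ (∈-map⁺ (lin X ∷_) (∈-map⁺ (bang M ∷_) a0))
  fireB-linSubB (bang M ∷ b) (inTail q) o a (lsb-tl cc) | b' , a0 , refl with fireB-linSubB b q o a0 cc
  ... | Tb , tb , rb , ob , m = bang M ∷ Tb , lsb-tl tb , inTail rb , ob , ∷-∈≈ᵇ m

fire-bagSub : ∀ {Q} A (p : TPos A) → Outer p → ∀ {A' U} → A' ∈ fire A p → BagSub Q A' U →
  Σ Term λ T → BagSub Q A T × Σ (TPos T) λ r → Outer r × U ∈≈ fire T r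
fire-bagSub A p o a bs-nil = A , bs-nil , p , o , ∈⇒∈≈ a
fire-bagSub A p o a (bs-lin a1 rest) with fire-linSub A p o a a1
... | T1 , t1 , r1 , o1 , (A1'' , m , e) with BagSub-≈-body e rest
... | U' , rest' , e' with fire-bagSub T1 r1 o1 m rest'
... | T , tt' , r , o' , m' = T , bs-lin t1 tt' , r , o' , ∈⟨⟩-respˡ ≈-trans e' m'
fire-bagSub A p o a (bs-bang a1 rest) with fire-parSub _ A p o a a1
... | T1 , t1 , r1 , o1 , (A1'' , m , e) with BagSub-≈-body e rest
... | U' , rest' , e' with fire-bagSub T1 r1 o1 m rest'
... | T , tt' , r , o' , m' = T , bs-bang t1 tt' , r , o' , ∈⟨⟩-respˡ ≈-trans e' m'

fire-giant-body : ∀ {P} A (p : TPos A) → Outer p → ∀ {A' U} → A' ∈ fire A p → Giant A' P U →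
  Σ Term λ T → Giant A P T × Σ (TPos T) λ r → Outer r × U ∈≈ fire T r
fire-giant-body A p o a (gi v w) with fire-bagSub A p o a v
... | T1 , t1 , r1 , o1 , (V' , m , e) with ParSub-≈ e w
... | U' , u' , e' with fire-parSub zeroSub T1 r1 o1 m u'
... | T , tt' , r , o' , m' = T , gi t1 tt' , r , o' , ∈⟨⟩-respˡ ≈-trans e' m'

fire-shift : ∀ {N N'} (p : TPos N) → Outer p → N' ∈ fire N p →
  Σ (TPos (shift N)) λ r → Outer r × shift N' ∈≈ fire (shift N) r
fire-shift {N} {N'} p o a with fire-parSub (renamingSub suc) N p o a (∈⇒ParSub N' (≡subst (shift N' ∈_) (sym (subst-renaming (λ _ → refl) N')) (here refl)))
... | T , tt0 , r , o' , m with ≡subst (T ∈_) (subst-renaming (λ _ → refl) N) (ParSub⇒∈ tt0)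
... | here refl = r , o' , m

∈≈ᵇ-fireB-inTail : ∀ {r b} {q : BPos b} {c} → c ∈≈ᵇ fireB b q → (r ∷ c) ∈≈ᵇ fireB (r ∷ b) (inTail q)
∈≈ᵇ-fireB-inTail {r} {b} {q} m = ≡subst (_ ∈≈ᵇ_) (sym (fireB-tail r b q)) (∷-∈≈ᵇ m)

mutual
  linSub-fire-arg : ∀ {x N N'} (p : TPos N) → Outer p → N' ∈ fire N p → ∀ A {U} → LinSub x N' A U →
    Σ Term λ T → LinSub x N A T × Σ (TPos T) λ r → Outer r × U ∈≈ fire T r
  linSub-fire-arg {N = N} p o a (var z) (ls-var e) = N , ls-var e , p , o , ∈⇒∈≈ a
  linSub-fire-arg {x} {N} {N'} p o a (lam A) (ls-lam {U = U0} u) with fire-shift p o a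
  ... | r' , o' , (V , v , e) with lsub-≈-arg {suc x} e A (LinSub⇒∈ u)
  ... | U0' , u' , e1 with linSub-fire-arg r' o' v A (∈⇒LinSub A u')
  ... | T0 , t0 , r0 , o0 , m = lam T0 , ls-lam t0 , inLam r0 , o0 , lam-∈≈ (∈⟨⟩-respˡ ≈-trans e1 m)
  linSub-fire-arg p o a (app A P) (ls-fun u) with linSub-fire-arg p o a A u
  ... | T0 , t0 , r0 , o0 , m = app T0 P , ls-fun t0 , inFun r0 , o0 , ∈≈-fire-inFun {A = T0} {p = r0} (app-∈≈ˡ m)
  linSub-fire-arg p o a (app A P) (ls-arg c) with linSubB-fire-arg p o a P c
  ... | Tb , tb , rb , ob , m = app A Tb , ls-arg tb , inArg rb , ob , ∈≈-fire-inArg {P = Tb} {q = rb} (app-∈≈ʳ m)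

  linSubB-fire-arg : ∀ {x N N'} (p : TPos N) → Outer p → N' ∈ fire N p → ∀ P {c} → LinSubB x N' P c →
    Σ Bag λ Tb → LinSubB x N P Tb × Σ (BPos Tb) λ rb → OuterB rb × c ∈≈ᵇ fireB Tb rb
  linSubB-fire-arg p o a (lin M ∷ b) (lsb-lin u) with linSub-fire-arg p o a M u
  ... | T0 , t0 , r0 , o0 , m = lin T0 ∷ b , lsb-lin t0 , inLin r0 , o0 , lin-∈≈ᵇ m
  linSubB-fire-arg p o a (bang M ∷ b) (lsb-bang u) with linSub-fire-arg p o a M u
  ... | T0 , t0 , r0 , o0 , m = lin T0 ∷ bang M ∷ b , lsb-bang t0 , inLin r0 , o0 , lin-∈≈ᵇ m
  linSubB-fire-arg p o a (r ∷ b) (lsb-tl c) with linSubB-fire-arg p o a b c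
  ... | Tb , tb , rb , ob , m = r ∷ Tb , lsb-tl tb , inTail rb , ob , ∈≈ᵇ-fireB-inTail {r} {Tb} {rb} m

bagSub-fireB : ∀ {A} P (q : BPos P) → OuterB q → ∀ {P' U} → P' ∈ fireB P q → BagSub P' A U →
  Σ Term λ T → BagSub P A T × Σ (TPos T) λ r → Outer r × U ∈≈ fire T r
bagSub-fireB {A} (lin R ∷ b) (inLin p) o a u with ∈-map⁻ (λ M' → lin M' ∷ b) a
bagSub-fireB {A} (lin R ∷ b) (inLin p) o a (bs-lin a1 rest) | R' , a0 , refl with fire-shift p o a0
... | r' , o' , (V , v , e) with lsub-≈-arg {0} e A (LinSub⇒∈ a1)
... | A1' , a1' , e1 with linSub-fire-arg r' o' v A (∈⇒LinSub A a1')
... | T1 , t1 , r1 , o1 , (A1'' , m , e2) with BagSub-≈-body (≈-trans e1 e2) rest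
... | U' , rest' , e3 with fire-bagSub T1 r1 o1 m rest'
... | T , tt' , r , o2 , m' = T , bs-lin t1 tt' , r , o2 , ∈⟨⟩-respˡ ≈-trans e3 m'
bagSub-fireB (bang R ∷ b) (inBang p) () a u
bagSub-fireB {A} (r0 ∷ b) (inTail q) o a u with ∈-map⁻ (r0 ∷_) (≡subst (_ ∈_) (fireB-tail r0 b q) a)
bagSub-fireB {A} (lin R ∷ b) (inTail q) o a (bs-lin a1 rest) | b' , a0 , refl with bagSub-fireB b q o a0 rest
... | T , tt' , r , o2 , m = T , bs-lin a1 tt' , r , o2 , m
bagSub-fireB {A} (bang R ∷ b) (inTail q) o a (bs-bang a1 rest) | b' , a0 , refl with bagSub-fireB b q o a0 rest
... | T , tt' , r , o2 , m = T , bs-bang a1 tt' , r , o2 , m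

giant-fireB : ∀ {A} P (q : BPos P) → OuterB q → ∀ {P' U} → P' ∈ fireB P q → Giant A P' U →
  Σ Term λ T → Giant A P T × Σ (TPos T) λ r → Outer r × U ∈≈ fire T r
giant-fireB P q o a (gi v w) with bagSub-fireB P q o a v
... | T1 , t1 , r1 , o1 , (V' , m , e) with ParSub-≈ e w
... | U' , u' , e' with fire-parSub zeroSub T1 r1 o1 m u'
... | T , tt' , r , o' , m' = T , gi t1 tt' , r , o' , ∈⟨⟩-respˡ ≈-trans e' m'

-- Leftmost redexes

Leftmost : Term → Set
Leftmost M = Σ (TPos M) InL

LeftmostB : Bag → Set
LeftmostB b = Σ (BPos b) InLB

mutual
  leftmost? : ∀ M → Dec (Leftmost M)
  leftmost? (var n) = no λ { (() , _) }
  leftmost? (lam M) with leftmost? M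
  ... | yes (p , l) = yes (inLam p , l)
  ... | no ¬l = no λ { (inLam p , l) → ¬l (p , l) }
  leftmost? (app (var n) P) = leftmost-app? (var n) P (λ ())
  leftmost? (app (lam B) P) = yes (here , tt)
  leftmost? (app (app M Q) P) = leftmost-app? (app M Q) P (λ ())

  leftmost-app? : ∀ M P → ¬ IsAbs M → Dec (Leftmost (app M P))
  leftmost-app? M P na with leftmost? M | leftmostB? P
  ... | yes (p , l) | _ = yes (inFun p , na , l)
  ... | no ¬l | yes (q , l) = yes (inArg q , na , ¬l , l)
  ... | no ¬l | no ¬lb = no λ
    { (here , _) → na tt
    ; (inFun p , _ , l) → ¬l (p , l)
    ; (inArg q , _ , _ , l) → ¬lb (q , l) }

  leftmostB? : ∀ b → Dec (LeftmostB b)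
  leftmostB? [] = no λ { (() , _) }
  leftmostB? (lin M ∷ b) with leftmost? M | leftmostB? b
  ... | yes (p , l) | _ = yes (inLin p , l)
  ... | no ¬l | yes (q , l) = yes (inTail q , l)
  ... | no ¬l | no ¬lb = no λ { (inLin p , l) → ¬l (p , l) ; (inTail q , l) → ¬lb (q , l) }
  leftmostB? (bang M ∷ b) with leftmostB? b
  ... | yes (q , l) = yes (inTail q , l)
  ... | no ¬lb = no λ { (inBang p , ()) ; (inTail q , l) → ¬lb (q , l) }

IsAbs-≈ : ∀ {M M'} → M ≈ M' → IsAbs M → IsAbs M'
IsAbs-≈ (lam e) t = tt

leftmost-app-≈ : ∀ {M M' P P'} → M ≈ M' → (Leftmost M → Leftmost M') × (Leftmost M' → Leftmost M) →
  (LeftmostB P → LeftmostB P') → Leftmost (app M P) → Leftmost (app M' P')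
leftmost-app-≈ (lam _) _ _ (here , _) = here , tt
leftmost-app-≈ e (to , _) _ (inFun p , na , l) =
  let (p' , l') = to (p , l) in inFun p' , (λ t → na (IsAbs-≈ (≈-sym e) t)) , l'
leftmost-app-≈ e (_ , from) toB (inArg q , na , ¬l , l) =
  let (q' , l') = toB (q , l) in inArg q' , (λ t → na (IsAbs-≈ (≈-sym e) t)) , (λ m → ¬l (from m)) , l'

leftmostB-swap : ∀ {r s b} → LeftmostB (r ∷ s ∷ b) → LeftmostB (s ∷ r ∷ b)
leftmostB-swap (inLin p , l) = inTail (inLin p) , l
leftmostB-swap (inBang p , ())
leftmostB-swap (inTail (inLin p) , l) = inLin p , l
leftmostB-swap (inTail (inBang p) , ())
leftmostB-swap (inTail (inTail q) , l) = inTail (inTail q) , l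

mutual
  leftmost-≈ : ∀ {M M'} → M ≈ M' → (Leftmost M → Leftmost M') × (Leftmost M' → Leftmost M)
  leftmost-≈ var = (λ { (() , _) }) , (λ { (() , _) })
  leftmost-≈ (lam e) =
    (λ { (inLam p , l) → let (p' , l') = proj₁ (leftmost-≈ e) (p , l) in inLam p' , l' }) ,
    (λ { (inLam p , l) → let (p' , l') = proj₂ (leftmost-≈ e) (p , l) in inLam p' , l' })
  leftmost-≈ (app e q) =
    leftmost-app-≈ e (leftmost-≈ e) (proj₁ (leftmostB-≈ q)) ,
    leftmost-app-≈ (≈-sym e) (proj₂ (leftmost-≈ e) , proj₁ (leftmost-≈ e)) (proj₂ (leftmostB-≈ q))

  leftmostB-≈ : ∀ {b b'} → b ≈ᵇ b' → (LeftmostB b → LeftmostB b') × (LeftmostB b' → LeftmostB b)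
  leftmostB-≈ nil = (λ { (() , _) }) , (λ { (() , _) })
  leftmostB-≈ (prep (lin e) q) =
    (λ { (inLin p , l) → let (p' , l') = proj₁ (leftmost-≈ e) (p , l) in inLin p' , l'
       ; (inTail r , l) → let (r' , l') = proj₁ (leftmostB-≈ q) (r , l) in inTail r' , l' }) ,
    (λ { (inLin p , l) → let (p' , l') = proj₂ (leftmost-≈ e) (p , l) in inLin p' , l'
       ; (inTail r , l) → let (r' , l') = proj₂ (leftmostB-≈ q) (r , l) in inTail r' , l' })
  leftmostB-≈ (prep (bang e) q) =
    (λ { (inBang p , ()) ; (inTail r , l) → let (r' , l') = proj₁ (leftmostB-≈ q) (r , l) in inTail r' , l' }) ,
    (λ { (inBang p , ()) ; (inTail r , l) → let (r' , l') = proj₂ (leftmostB-≈ q) (r , l) in inTail r' , l' })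
  leftmostB-≈ swap = leftmostB-swap , leftmostB-swap
  leftmostB-≈ (trans p q) =
    (λ m → proj₁ (leftmostB-≈ q) (proj₁ (leftmostB-≈ p) m)) ,
    (λ m → proj₂ (leftmostB-≈ p) (proj₂ (leftmostB-≈ q) m))

mutual
  InL⇒Outer : ∀ {M} (p : TPos M) → InL p → Outer p
  InL⇒Outer here l = tt
  InL⇒Outer (inLam p) l = InL⇒Outer p l
  InL⇒Outer {app M P} (inFun p) (na , l) = InL⇒Outer p l
  InL⇒Outer {app M P} (inArg q) (na , nl , l) = InLB⇒OuterB q l

  InLB⇒OuterB : ∀ {b} (q : BPos b) → InLB q → OuterB q
  InLB⇒OuterB (inLin p) l = InL⇒Outer p l
  InLB⇒OuterB (inBang p) ()
  InLB⇒OuterB (inTail q) l = InLB⇒OuterB q l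

Transported : ∀ {M} (M₀ : Term) → TPos M → Set
Transported {M} M₀ p = Σ (TPos M₀) λ p₀ → Outer p₀ × (InL p → InL p₀) × fire M p ⊑ fire M₀ p₀

TransportedB : ∀ {b} (b₀ : Bag) → BPos b → Set
TransportedB {b} b₀ q = Σ (BPos b₀) λ q₀ → OuterB q₀ × (InLB q → InLB q₀) × fireB b q ⊑ᵇ fireB b₀ q₀

transportB-swap : ∀ {r s b} (q : BPos (r ∷ s ∷ b)) → OuterB q → TransportedB (s ∷ r ∷ b) q
transportB-swap {lin M} {s} {b} (inLin p) o = inTail (inLin p) , o , (λ l → l) , λ u → g u
  where
  g : ∀ {c} → c ∈ fireB (lin M ∷ s ∷ b) (inLin p) → c ∈≈ᵇ fireB (s ∷ lin M ∷ b) (inTail (inLin p))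
  g u with ∈-map⁻ (λ M' → lin M' ∷ s ∷ b) u
  ... | X , xx , refl = s ∷ lin X ∷ b , ≡subst (_ ∈_) (sym (fireB-tail s (lin M ∷ b) (inLin p))) (∈-map⁺ (s ∷_) (∈-map⁺ (λ M' → lin M' ∷ b) xx)) , swap
transportB-swap {bang M} (inBang p) ()
transportB-swap {r} {lin M} {b} (inTail (inLin p)) o = inLin p , o , (λ l → l) , λ u → g u
  where
  g : ∀ {c} → c ∈ fireB (r ∷ lin M ∷ b) (inTail (inLin p)) → c ∈≈ᵇ fireB (lin M ∷ r ∷ b) (inLin p)
  g u with ∈-map⁻ (r ∷_) (≡subst (_ ∈_) (fireB-tail r (lin M ∷ b) (inLin p)) u)
  ... | c , cc , refl with ∈-map⁻ (λ M' → lin M' ∷ b) cc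
  ... | X , xx , refl = lin X ∷ r ∷ b , ∈-map⁺ (λ M' → lin M' ∷ r ∷ b) xx , swap
transportB-swap {r} {bang M} (inTail (inBang p)) ()
transportB-swap {r} {s} {b} (inTail (inTail q)) o = inTail (inTail q) , o , (λ l → l) , λ u → g u
  where
  g : ∀ {c} → c ∈ fireB (r ∷ s ∷ b) (inTail (inTail q)) → c ∈≈ᵇ fireB (s ∷ r ∷ b) (inTail (inTail q))
  g u with ∈-map⁻ (r ∷_) (≡subst (_ ∈_) (fireB-tail r (s ∷ b) (inTail q)) u)
  ... | c , cc , refl with ∈-map⁻ (s ∷_) (≡subst (_ ∈_) (fireB-tail s b q) cc)
  ... | d , dd , refl = s ∷ r ∷ d ,
        ≡subst (_ ∈_) (sym (fireB-tail s (r ∷ b) (inTail q)))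
          (∈-map⁺ (s ∷_) (≡subst (_ ∈_) (sym (fireB-tail r b q)) (∈-map⁺ (r ∷_) dd))) , swap

mutual
  transport : ∀ {M M₀} → M ≈ M₀ → (p : TPos M) → Outer p → Transported M₀ p
  transport (app {lam B} {lam B₀} {Q} {Q₀} (lam eB) eQ) here o =
    here , tt , (λ l → tt) , λ u → f (Giant-≈ eB eQ (∈⇒Giant B Q u))
    where
    f : ∀ {U} → Σ Term (λ U' → Giant B₀ Q₀ U' × U ≈ U') → U ∈≈ giant B₀ Q₀
    f (U' , g , e) = U' , Giant⇒∈ g , e
  transport (lam {M} {M₀} e) (inLam p) o with transport e p o
  ... | p₀ , o₀ , il , fm = inLam p₀ , o₀ , il , λ u → g u
    where
    g : ∀ {U} → U ∈ fire (lam M) (inLam p) → U ∈≈ fire (lam M₀) (inLam p₀)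
    g u with ∈-map⁻ lam u
    ... | U0 , u0 , refl = lam-∈≈ (fm u0)
  transport (app {M} {M₀} {P} {P₀} e1 e2) (inFun p) o with transport e1 p o
  ... | p₀ , o₀ , il , fm = inFun p₀ , o₀ , (λ { (na , l) → (λ t → na (IsAbs-≈ (≈-sym e1) t)) , il l }) , λ u → g u
    where
    g : ∀ {U} → U ∈ fire (app M P) (inFun p) → U ∈≈ fire (app M₀ P₀) (inFun p₀)
    g u with ∈-fire-inFun⁻ {M} {P} {p} u
    ... | U0 , u0 , refl with fm u0
    ... | V , v , r = app V P₀ , ∈-fire-inFun⁺ {M₀} {P₀} {p₀} v , app r e2
  transport (app {M} {M₀} {P} {P₀} e1 e2) (inArg q) o with transportB e2 q o
  ... | q₀ , o₀ , il , fm = inArg q₀ , o₀ , (λ { (na , nl , l) → (λ t → na (IsAbs-≈ (≈-sym e1) t)) , (λ m → nl (proj₂ (leftmost-≈ e1) m)) , il l }) , λ u → g u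
    where
    g : ∀ {U} → U ∈ fire (app M P) (inArg q) → U ∈≈ fire (app M₀ P₀) (inArg q₀)
    g u with ∈-fire-inArg⁻ {M} {P} {q} u
    ... | c , cc , refl with fm cc
    ... | d , dd , r = app M₀ d , ∈-fire-inArg⁺ {M₀} {P₀} {q₀} dd , app e1 r

  transportB : ∀ {b b₀} → b ≈ᵇ b₀ → (q : BPos b) → OuterB q → TransportedB b₀ q
  transportB (prep {b = b} {b' = b₀} (lin {M} {M₀} e) e2) (inLin p) o with transport e p o
  ... | p₀ , o₀ , il , fm = inLin p₀ , o₀ , il , λ u → g u
    where
    g : ∀ {c} → c ∈ fireB (lin M ∷ b) (inLin p) → c ∈≈ᵇ fireB (lin M₀ ∷ b₀) (inLin p₀)
    g u with ∈-map⁻ (λ M' → lin M' ∷ b) u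
    ... | X , xx , refl with fm xx
    ... | Y , yy , r = lin Y ∷ b₀ , ∈-map⁺ (λ M' → lin M' ∷ b₀) yy , prep (lin r) e2
  transportB (prep (bang e) e2) (inBang p) ()
  transportB (prep {r} {r₀} {b} {b₀} e1 e2) (inTail q) o with transportB e2 q o
  ... | q₀ , o₀ , il , fm = inTail q₀ , o₀ , il , λ u → g u
    where
    g : ∀ {c} → c ∈ fireB (r ∷ b) (inTail q) → c ∈≈ᵇ fireB (r₀ ∷ b₀) (inTail q₀)
    g u with ∈-map⁻ (r ∷_) (≡subst (_ ∈_) (fireB-tail r b q) u)
    ... | c , cc , refl with fm cc
    ... | d , dd , rr = r₀ ∷ d , ≡subst (_ ∈_) (sym (fireB-tail r₀ b₀ q₀)) (∈-map⁺ (r₀ ∷_) dd) , prep e1 rr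
  transportB swap q o = transportB-swap q o
  transportB (trans e e') q o with transportB e q o
  ... | q₁ , o₁ , il₁ , fm₁ with transportB e' q₁ o₁
  ... | q₂ , o₂ , il₂ , fm₂ = q₂ , o₂ , (λ l → il₂ (il₁ l)) , λ u → ∈≈ᵇ-⊑ fm₂ (fm₁ u)

mutual
  outer⇒leftmost : ∀ M (p : TPos M) → Outer p → Leftmost M
  outer⇒leftmost (app (lam B) Q) here o = here , tt
  outer⇒leftmost (lam M) (inLam p) o with outer⇒leftmost M p o
  ... | p' , l = inLam p' , l
  outer⇒leftmost (app (var n) P) (inFun ()) o
  outer⇒leftmost (app (lam B) P) (inFun p) o = here , tt
  outer⇒leftmost (app (app M Q) P) (inFun p) o with outer⇒leftmost (app M Q) p o
  ... | p' , l = inFun p' , (λ ()) , l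
  outer⇒leftmost (app (lam B) P) (inArg q) o = here , tt
  outer⇒leftmost (app (var n) P) (inArg q) o with outerB⇒leftmostB P q o
  ... | q' , l = inArg q' , (λ ()) , (λ { (() , _) }) , l
  outer⇒leftmost (app (app M Q) P) (inArg q) o with leftmost? (app M Q)
  ... | yes (p' , l) = inFun p' , (λ ()) , l
  ... | no ¬l with outerB⇒leftmostB P q o
  ...   | q' , l = inArg q' , (λ ()) , ¬l , l

  outerB⇒leftmostB : ∀ P (q : BPos P) → OuterB q → LeftmostB P
  outerB⇒leftmostB (lin M ∷ b) (inLin p) o with outer⇒leftmost M p o
  ... | p' , l = inLin p' , l
  outerB⇒leftmostB (bang M ∷ b) (inBang p) ()
  outerB⇒leftmostB (r ∷ b) (inTail q) o with outerB⇒leftmostB b q o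
  ... | q' , l = inTail q' , l

mutual
  leftmost-survives : ∀ M (p0 : TPos M) → InL p0 → (p : TPos M) → Outer p → ¬ InL p → ∀ {S} → S ∈ fire M p → Σ (TPos S) Outer
  leftmost-survives (app (lam B) Q) here l0 here o nl s = ⊥-elim (nl tt)
  leftmost-survives (app (lam B) Q) here l0 (inFun (inLam p)) o nl s with ∈-fire-inFun⁻ {lam B} {Q} {inLam p} s
  ... | S1 , s1 , refl with ∈-map⁻ lam s1
  ... | S2 , s2 , refl = here , tt
  leftmost-survives (app (lam B) Q) here l0 (inArg q) o nl s with ∈-fire-inArg⁻ {lam B} {Q} {q} s
  ... | P' , s1 , refl = here , tt
  leftmost-survives (lam M) (inLam p0) l0 (inLam p) o nl s with ∈-map⁻ lam s
  ... | S0 , s0 , refl with leftmost-survives M p0 l0 p o nl s0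
  ... | r , or = inLam r , or
  leftmost-survives (app M P) (inFun p0) (na , l0) here o nl s = ⊥-elim (na tt)
  leftmost-survives (app M P) (inFun p0) (na , l0) (inFun p) o nl s with ∈-fire-inFun⁻ {M} {P} {p} s
  ... | S1 , s1 , refl with leftmost-survives M p0 l0 p o (λ l → nl (na , l)) s1
  ... | r , or = inFun r , or
  leftmost-survives (app M P) (inFun p0) (na , l0) (inArg q) o nl s with ∈-fire-inArg⁻ {M} {P} {q} s
  ... | P' , s1 , refl = inFun p0 , InL⇒Outer p0 l0
  leftmost-survives (app M P) (inArg q0) (na , nl0 , lb0) here o nl s = ⊥-elim (na tt)
  leftmost-survives (app M P) (inArg q0) (na , nl0 , lb0) (inFun p) o nl s = ⊥-elim (nl0 (outer⇒leftmost M p o))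
  leftmost-survives (app M P) (inArg q0) (na , nl0 , lb0) (inArg q) o nl s with ∈-fire-inArg⁻ {M} {P} {q} s
  ... | P' , s1 , refl with leftmostB-survives P q0 lb0 q o (λ lb → nl (na , nl0 , lb)) s1
  ... | rb , orb = inArg rb , orb

  leftmostB-survives : ∀ P (q0 : BPos P) → InLB q0 → (q : BPos P) → OuterB q → ¬ InLB q → ∀ {P'} → P' ∈ fireB P q → Σ (BPos P') OuterB
  leftmostB-survives (lin M ∷ b) (inLin p0) l0 (inLin p) o nl s with ∈-map⁻ (λ M' → lin M' ∷ b) s
  ... | S , s0 , refl with leftmost-survives M p0 l0 p o nl s0
  ... | r , or = inLin r , or
  leftmostB-survives (lin M ∷ b) (inLin p0) l0 (inTail q) o nl s with ∈-map⁻ (lin M ∷_) s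
  ... | b' , s0 , refl = inLin p0 , InL⇒Outer p0 l0
  leftmostB-survives (bang M ∷ b) (inBang p0) () q o nl s
  leftmostB-survives (lin M ∷ b) (inTail q0) l0 (inLin p) o nl s with ∈-map⁻ (λ M' → lin M' ∷ b) s
  ... | S , s0 , refl = inTail q0 , InLB⇒OuterB q0 l0
  leftmostB-survives (bang M ∷ b) (inTail q0) l0 (inBang p) () nl s
  leftmostB-survives (r ∷ b) (inTail q0) l0 (inTail q) o nl s with ∈-map⁻ (r ∷_) (≡subst (_ ∈_) (fireB-tail r b q) s)
  ... | b' , s0 , refl with leftmostB-survives b q0 l0 q o nl s0
  ... | rb , orb = inTail rb , orb

-- Swapping a non-leftmost and a leftmost step

fire-¬InL-app : ∀ M Q (p : TPos (app M Q)) → ¬ InL p → ∀ {S} → S ∈ fire (app M Q) p → Σ Term λ a → Σ Bag λ b → S ≡ app a b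
fire-¬InL-app (lam B) Q here nl s = ⊥-elim (nl tt)
fire-¬InL-app M Q (inFun p) nl s with ∈-fire-inFun⁻ {M} {Q} {p} s
... | S1 , s1 , refl = S1 , Q , refl
fire-¬InL-app M Q (inArg q) nl s with ∈-fire-inArg⁻ {M} {Q} {q} s
... | P' , s1 , refl = M , P' , refl

LmThenOuter : Term → Term → Set
LmThenOuter M X = Σ Term λ M'' → (Σ (TPos M) λ p0 → Outer p0 × InL p0 × M'' ∈ fire M p0) × Σ (TPos M'') λ r → Outer r × X ∈≈ fire M'' r

LmThenOuterB : Bag → Bag → Set
LmThenOuterB P c = Σ Bag λ P'' → (Σ (BPos P) λ q0 → OuterB q0 × InLB q0 × P'' ∈ fireB P q0) × Σ (BPos P'') λ rb → OuterB rb × c ∈≈ᵇ fireB P'' rb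

swap-into-body : ∀ A P (p : TPos A) → Outer p → ∀ {A' X} → A' ∈ fire A p →
  (p' : TPos (app (lam A') P)) → InL p' → X ∈ fire (app (lam A') P) p' → LmThenOuter (app (lam A) P) X
swap-into-body A P p o a here _ x with fire-giant-body A p o a (∈⇒Giant _ P x)
... | T , g , r , or , m = T , (here , tt , tt , Giant⇒∈ g) , (r , or , m)
swap-into-body A P p o a (inFun _) (na , _) x = ⊥-elim (na tt)
swap-into-body A P p o a (inArg _) (na , _) x = ⊥-elim (na tt)

swap-into-bag : ∀ A P (q : BPos P) → OuterB q → ∀ {P' X} → P' ∈ fireB P q →
  (p' : TPos (app (lam A) P')) → InL p' → X ∈ fire (app (lam A) P') p' → LmThenOuter (app (lam A) P) X
swap-into-bag A P q o s here _ x with giant-fireB P q o s (∈⇒Giant A _ x)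
... | T , g , r , or , m = T , (here , tt , tt , Giant⇒∈ g) , (r , or , m)
swap-into-bag A P q o s (inFun _) (na , _) x = ⊥-elim (na tt)
swap-into-bag A P q o s (inArg _) (na , _) x = ⊥-elim (na tt)

mutual
  swap-¬lm-lm : ∀ M (p : TPos M) → Outer p → ¬ InL p → ∀ {S} → S ∈ fire M p →
    (p' : TPos S) → InL p' → ∀ {X} → X ∈ fire S p' → LmThenOuter M X
  swap-¬lm-lm (app (lam B) Q) here o nl s p' l x = ⊥-elim (nl tt)
  swap-¬lm-lm (lam M) (inLam p) o nl s p' l x with ∈-map⁻ lam s
  swap-¬lm-lm (lam M) (inLam p) o nl s (inLam p'') l x | S0 , s0 , refl with ∈-map⁻ lam x
  ... | X0 , x0 , refl with swap-¬lm-lm M p o nl s0 p'' l x0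
  ... | M'' , (p0 , o0 , l0 , m0) , (r , or , mr) = lam M'' , (inLam p0 , o0 , l0 , ∈-map⁺ lam m0) , (inLam r , or , lam-∈≈ mr)
  swap-¬lm-lm (app (var n) P) (inFun ()) o nl s p' l x
  swap-¬lm-lm (app (lam A) P) (inFun (inLam p)) o nl s p' l x with ∈-fire-inFun⁻ {lam A} {P} {inLam p} s
  ... | S1 , s1 , refl with ∈-map⁻ lam s1
  ...   | A' , a , refl = swap-into-body A P p o a p' l x
  swap-¬lm-lm (app (app M2 Q) P) (inFun p1) o nl s p' l x with ∈-fire-inFun⁻ {app M2 Q} {P} {p1} s
  ... | S1 , s1 , refl with fire-¬InL-app M2 Q p1 (λ l1 → nl ((λ ()) , l1)) s1
  swap-¬lm-lm (app (app M2 Q) P) (inFun p1) o nl s (inFun p'') (na , l'') x | S1 , s1 , refl | a , b , refl with ∈-fire-inFun⁻ {app a b} {P} {p''} x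
  ... | X0 , x0 , refl with swap-¬lm-lm (app M2 Q) p1 o (λ l1 → nl ((λ ()) , l1)) s1 p'' l'' x0
  ... | M1'' , (p0 , o0 , l0 , m0) , (r , or , mr) =
    app M1'' P , (inFun p0 , o0 , ((λ ()) , l0) , ∈-fire-inFun⁺ {app M2 Q} {P} {p0} m0) , (inFun r , or , ∈≈-fire-inFun {A = M1''} {p = r} (app-∈≈ˡ mr))
  -- the function part of S still has an outer redex, so the leftmost one of S is not in b
  swap-¬lm-lm (app (app M2 Q) P) (inFun p1) o nl s (inArg q'') (na , nlS , lb) x | S1 , s1 , refl | a , b , refl
    with outer⇒leftmost (app M2 Q) p1 o
  ... | p0' , l0' with leftmost-survives (app M2 Q) p0' l0' p1 o (λ l1 → nl ((λ ()) , l1)) s1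
  ... | rS , oS = ⊥-elim (nlS (outer⇒leftmost (app a b) rS oS))
  swap-¬lm-lm (app (lam A) P) (inArg q) o nl s p' l x with ∈-fire-inArg⁻ {lam A} {P} {q} s
  ... | P' , s' , refl = swap-into-bag A P q o s' p' l x
  swap-¬lm-lm (app (var n) P) (inArg q) o nl s p' l x = swap-¬lm-lm-arg (var n) P (λ ()) q o nl s p' l x
  swap-¬lm-lm (app (app M2 Q) P) (inArg q) o nl s p' l x = swap-¬lm-lm-arg (app M2 Q) P (λ ()) q o nl s p' l x

  swap-¬lm-lm-arg : ∀ M1 P → ¬ IsAbs M1 → (q : BPos P) → OuterB q → ¬ InL {app M1 P} (inArg q) → ∀ {S} → S ∈ fire (app M1 P) (inArg q) →
    (p' : TPos S) → InL p' → ∀ {X} → X ∈ fire S p' → LmThenOuter (app M1 P) X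
  swap-¬lm-lm-arg M1 P na q o nl s p' l x with ∈-fire-inArg⁻ {M1} {P} {q} s
  ... | P' , s' , refl with leftmost? M1
  swap-¬lm-lm-arg (lam B) P na q o nl s here l x | P' , s' , refl | _ = ⊥-elim (na tt)
  swap-¬lm-lm-arg M1 P na q o nl s (inFun p'') (_ , l'') x | P' , s' , refl | yes _ with ∈-fire-inFun⁻ {M1} {P'} {p''} x
  ... | X0 , x0 , refl =
    app X0 P , (inFun p'' , InL⇒Outer p'' l'' , (na , l'') , ∈-fire-inFun⁺ {M1} {P} {p''} x0) , (inArg q , o , ∈⇒∈≈ (∈-fire-inArg⁺ {X0} {P} {q} s'))
  swap-¬lm-lm-arg M1 P na q o nl s (inArg q'') (_ , ¬l , lb) x | P' , s' , refl | yes l₀ = ⊥-elim (¬l l₀)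
  swap-¬lm-lm-arg M1 P na q o nl s (inFun p'') (_ , l'') x | P' , s' , refl | no ¬l = ⊥-elim (¬l (p'' , l''))
  swap-¬lm-lm-arg M1 P na q o nl s (inArg q'') (_ , _ , lb) x | P' , s' , refl | no ¬l with ∈-fire-inArg⁻ {M1} {P'} {q''} x
  ... | c , cc , refl with swap-¬lmB-lmB P q o (λ lb0 → nl (na , ¬l , lb0)) s' q'' lb cc
  ... | P'' , (q0 , oq0 , lq0 , m0) , (rb , orb , mrb) =
    app M1 P'' , (inArg q0 , oq0 , (na , ¬l , lq0) , ∈-fire-inArg⁺ {M1} {P} {q0} m0) , (inArg rb , orb , ∈≈-fire-inArg {P = P''} {q = rb} (app-∈≈ʳ mrb))

  swap-¬lmB-lmB : ∀ P (q : BPos P) → OuterB q → ¬ InLB q → ∀ {P'} → P' ∈ fireB P q →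
    (q' : BPos P') → InLB q' → ∀ {c} → c ∈ fireB P' q' → LmThenOuterB P c
  swap-¬lmB-lmB (lin M ∷ b) (inLin p) o nl s q' l x with ∈-map⁻ (λ M' → lin M' ∷ b) s
  swap-¬lmB-lmB (lin M ∷ b) (inLin p) o nl s (inLin p'') l x | S , s0 , refl with ∈-map⁻ (λ M' → lin M' ∷ b) x
  ... | X , x0 , refl with swap-¬lm-lm M p o nl s0 p'' l x0
  ... | M'' , (p0 , o0 , l0 , m0) , (r , or , mr) =
    lin M'' ∷ b , (inLin p0 , o0 , l0 , ∈-map⁺ (λ M' → lin M' ∷ b) m0) , (inLin r , or , lin-∈≈ᵇ mr)
  swap-¬lmB-lmB (lin M ∷ b) (inLin p) o nl s (inTail q2) l x | S , s0 , refl with ∈-map⁻ (lin S ∷_) x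
  ... | c0 , x0 , refl =
    lin M ∷ c0 , (inTail q2 , InLB⇒OuterB q2 l , l , ∈-map⁺ (lin M ∷_) x0) , (inLin p , o , ∈⇒∈≈ᵇ (∈-map⁺ (λ M' → lin M' ∷ c0) s0))
  swap-¬lmB-lmB (bang M ∷ b) (inBang p) () nl s q' l x
  swap-¬lmB-lmB (r0 ∷ b) (inTail q1) o nl s q' l x with ∈-map⁻ (r0 ∷_) (≡subst (_ ∈_) (fireB-tail r0 b q1) s)
  swap-¬lmB-lmB (lin M' ∷ b) (inTail q1) o nl s (inLin p'') l x | b' , s0 , refl with ∈-map⁻ (λ M'' → lin M'' ∷ b') x
  ... | X , x0 , refl =
    lin X ∷ b , (inLin p'' , InL⇒Outer p'' l , l , ∈-map⁺ (λ M'' → lin M'' ∷ b) x0) , (inTail q1 , o , ∈⇒∈≈ᵇ (∈-map⁺ (lin X ∷_) s0))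
  swap-¬lmB-lmB (r0 ∷ b) (inTail q1) o nl s (inTail q2) l x | b' , s0 , refl with ∈-map⁻ (r0 ∷_) (≡subst (_ ∈_) (fireB-tail r0 b' q2) x)
  ... | c0 , x0 , refl with swap-¬lmB-lmB b q1 o nl s0 q2 l x0
  ... | P0 , (q0 , oq0 , lq0 , m0) , (rb , orb , mrb) =
    r0 ∷ P0 , (inTail q0 , oq0 , lq0 , ≡subst (_ ∈_) (sym (fireB-tail r0 b q0)) (∈-map⁺ (r0 ∷_) m0)) , (inTail rb , orb , ∈≈ᵇ-fireB-inTail {r0} {P0} {rb} mrb)
  swap-¬lmB-lmB (bang M' ∷ b) (inTail q1) o nl s (inBang p'') () x | b' , s0 , refl

lemma3p9 : (M M' N : Term) → M →¬lm M' → M' →lm N →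
    Σ Term (λ M'' → (M →lm M'') × (M'' →o N))
-- M' is only ≈ to a summand S of the first step, so the leftmost position is first moved to S.
lemma3p9 M M' N (p , o , nl , mS) (p' , o' , l' , mN) with find mS
... | S , s , eS with transport eS p' o'
... | p₀ , o₀ , il , fm with find mN
... | X' , x' , eN with fm x'
... | X , x , eX with swap-¬lm-lm M p o nl s p₀ (il l') x
... | M'' , (p0 , o0 , l0 , m0) , (r , or , mr) =
  M'' , (p0 , o0 , l0 , ∈≈⇒∈Σ (∈⇒∈≈ m0)) , (r , or , ∈≈⇒∈Σ (∈⟨⟩-respˡ ≈-trans (≈-trans eN eX) mr))
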